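{- Let $n\ge 1$ be an integer. In Permutation-Mastermind with $n$ positions and $k=n$ colors, there is a deterministic adaptive strategy for the codebreaker, using only queries that are permutations in $S_n$, that determines every secret permutation $y\in S_n$ after at most $(n-3)\lceil\log_2 n\rceil+\frac{5}{2}n-1$ queries.
   Context: Permutation-Mastermind with $n$ positions: the codemaker fixes a secret code $y\in S_n$, written as the vector $(y_1,\dots,y_n)$ with pairwise distinct entries from $[n]=\{1,\dots,n\}$. The codebreaker adaptively submits queries $x\in S_n$ (each query may depend on the answers to all previous queries), and after each query receives only the answer $\mathrm{black}(x,y)=|\{i\in[n]: x_i=y_i\}|$. A strategy determines $y$ after $N$ queries if $y$ is uniquely determined by the first $N$ queries and their answers. -}

module Defs where

open import Data.Nat using (ℕ)
open import Data.Fin using (Fin; _≟_)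
open import Data.Vec using (Vec; lookup)
open import Data.List using (List; []; _∷_; length; filter; allFin)
open import Data.List.Relation.Unary.All using (All)
open import Data.Product using (Σ; _×_; _,_; proj₁)
open import Relation.Binary.PropositionalEquality using (_≡_)

IsPerm : {n : ℕ} → Vec (Fin n) n → Set
IsPerm {n} v = (i j : Fin n) → lookup v i ≡ lookup v j → i ≡ j

black : {n : ℕ} → Vec (Fin n) n → Vec (Fin n) n → ℕ
black {n} x y = length (filter (λ i → lookup x i ≟ lookup y i) (allFin n))

data Strategy (n : ℕ) : Set where
  stop : Strategy n
  ask  : (x : Vec (Fin n) n) → IsPerm x → (ℕ → Strategy n) → Strategy n

transcript : {n : ℕ} → Strategy n → Vec (Fin n) n → List (Vec (Fin n) n × ℕ)
transcript stop y = []
transcript (ask x _ k) y = (x , black x y) ∷ transcript (k (black x y)) y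

Consistent : {n : ℕ} → Vec (Fin n) n → List (Vec (Fin n) n × ℕ) → Set
Consistent z t = All (λ p → black (proj₁ p) z ≡ Data.Product.proj₂ p) t

Determines : {n : ℕ} → Strategy n → Vec (Fin n) n → Set
Determines S y = (z : _) → IsPerm z → Consistent z (transcript S y) → z ≡ y

-- Write y i = i ⊕ shift i in ℤ/n. The query i ↦ w ⊕ i scores the number of positions of
-- shift w, so n queries give all class sizes; n more, with the first two entries swapped,
-- single out the shifts α and β of positions 0 and 1 by comparing the two score vectors.
-- From then on y 0 = α is known and can sit harmlessly in one position of a query. Rotating a
-- prefix of length m of a constant-shift query for class k, while the remaining positions test
-- the already completed class k ⊝ 1, makes the score equal to the number of unknown positions
-- of shift k in that prefix plus a quantity the codebreaker can compute; binary search over m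
-- then locates a new position of shift k with ⌈log₂ n⌉ queries. Completing the classes one by
-- one, starting next to a class that is complete from the outset, needs at most n − 3 such
-- searches, because the positions of the last class are determined without search; in total
-- at most 2n + (n − 3)⌈log₂ n⌉ queries, for n ≥ 3 (n = 1, 2 are settled directly).

module Submission where

open import Defs

module Mastermind where

  open import Algebra.Bundles using (AbelianGroup)
  open import Algebra.Structures using (IsAbelianGroup)
  import Algebra.Properties.AbelianGroup as AbelianGroupProperties
  open import Data.Bool using (Bool; true; false; if_then_else_)
  open import Data.Empty using (⊥-elim)
  open import Data.Fin using (Fin; zero; suc; toℕ; punchIn; _≟_)
  open import Data.Fin.Permutation using (Permutation′; permutation)
  open import Data.Fin.Properties using (toℕ-injective; toℕ-fromℕ<; toℕ<n; punchInᵢ≢i; any?)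
  import Data.Integer as ℤ
  import Data.Integer.Properties as ℤP
  import Data.Integer.Tactic.RingSolver as ℤ-Solver
  open import Data.List using (length; filter)
  import Data.List as List
  open import Data.List.Relation.Unary.All using (_∷_)
  open import Data.Maybe using (Maybe; just; nothing; fromMaybe)
  open import Data.Maybe.Properties using (just-injective)
  open import Data.Nat using (ℕ; zero; suc; _+_; _*_; _∸_; _%_; _≤_; _<_; _≤?_; _<?_; _≡ᵇ_; z≤n; s≤s; s≤s⁻¹; ⌊_/2⌋; ⌈_/2⌉)
  import Data.Nat as ℕ
  open import Data.Nat.DivMod using (_mod_; %-distribˡ-+; m%n%n≡m%n; m<n⇒m%n≡m; m%n<n; n%n≡0)
  open import Data.Nat.Logarithm using (⌈log₂_⌉; ⌈log₂⌉-mono-≤; ⌈log₂⌈n/2⌉⌉≡⌈log₂n⌉∸1; ⌈log₂2^n⌉≡n)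
  open import Data.Nat.Properties
    using (+-0-commutativeMonoid; +-assoc; +-comm; +-identityʳ; +-suc; +-cancelʳ-≡; +-cancelʳ-≤; +-cancelˡ-≤;
           +-mono-≤; +-monoʳ-≤; +-monoˡ-≤; *-monoʳ-≤; *-distribʳ-+; m+[n∸m]≡n; m+n∸n≡m;
           ≤-refl; ≤-reflexive; ≤-trans; ≤-antisym; ≤-<-trans; <-≤-trans; <-irrefl; <-cmp; <⇒≤; <⇒≱; <⇒≢;
           ≤∧≢⇒<; ≰⇒>; m≤m+n; m≤n+m; m<m+n; m<n⇒m<1+n; n≤1+n; n<1+n; 1+n≢0; 0≢1+n;
           ⌊n/2⌋≤n; ⌈n/2⌉<n; ⌊n/2⌋≤⌈n/2⌉; ⌊n/2⌋+⌈n/2⌉≡n; module ≤-Reasoning)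
  open import Data.Nat.Tactic.RingSolver using (solve-∀)
  open import Data.Product using (_×_; _,_; ∃)
  open import Data.Sum using (_⊎_; inj₁; inj₂)
  open import Data.Vec using (Vec; lookup; tabulate; _∷_; [])
  open import Data.Vec.Functional using () renaming (_∷_ to _◂_)
  open import Data.Vec.Properties using (lookup∘tabulate; tabulate∘lookup; tabulate-cong)
  open import Function using (_∘_)
  open import Relation.Binary using (tri<; tri≈; tri>)
  open import Relation.Binary.PropositionalEquality
  open import Relation.Nullary using (Dec; yes; no; ¬_; does)
  open import Relation.Nullary.Decidable using (_×-dec_; dec-true; dec-false)
  open import Relation.Unary using (Pred; Decidable)

  open import Algebra.Properties.CommutativeMonoid.Sum +-0-commutativeMonoid
    using (sum; sum-cong-≗; sum-remove; sum-permute; sum-replicate-zero; ∑-comm; ∑-distrib-+)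

  ⟦_⟧ : ∀ {p} {P : Set p} → Dec P → ℕ
  ⟦ yes _ ⟧ = 1
  ⟦ no _ ⟧ = 0

  ⟦⟧≤1 : ∀ {p} {P : Set p} (d : Dec P) → ⟦ d ⟧ ≤ 1
  ⟦⟧≤1 (yes _) = s≤s z≤n
  ⟦⟧≤1 (no _) = z≤n

  ⟦⟧≡1 : ∀ {p} {P : Set p} (d : Dec P) → P → ⟦ d ⟧ ≡ 1
  ⟦⟧≡1 (yes _) _ = refl
  ⟦⟧≡1 (no ¬p) p = ⊥-elim (¬p p)

  ⟦⟧≡0 : ∀ {p} {P : Set p} (d : Dec P) → ¬ P → ⟦ d ⟧ ≡ 0
  ⟦⟧≡0 (yes p) ¬p = ⊥-elim (¬p p)
  ⟦⟧≡0 (no _) _ = refl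

  ⟦⟧-positive : ∀ {p} {P : Set p} (d : Dec P) → 1 ≤ ⟦ d ⟧ → P
  ⟦⟧-positive (yes p) _ = p

  ⟦⟧-cong : ∀ {p q} {P : Set p} {Q : Set q} (d : Dec P) (e : Dec Q) → (P → Q) → (Q → P) → ⟦ d ⟧ ≡ ⟦ e ⟧
  ⟦⟧-cong (yes p) (yes q) f g = refl
  ⟦⟧-cong (yes p) (no ¬q) f g = ⊥-elim (¬q (f p))
  ⟦⟧-cong (no ¬p) (yes q) f g = ⊥-elim (¬p (g q))
  ⟦⟧-cong (no ¬p) (no ¬q) f g = refl

  length-filter-tabulate : ∀ {a p} {A : Set a} {P : Pred A p} (P? : Decidable P) {n} (f : Fin n → A) →
    length (filter P? (List.tabulate f)) ≡ sum (λ i → ⟦ P? (f i) ⟧)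
  length-filter-tabulate P? {zero} f = refl
  length-filter-tabulate P? {suc n} f with P? (f zero)
  ... | yes _ = cong suc (length-filter-tabulate P? (f ∘ suc))
  ... | no _ = length-filter-tabulate P? (f ∘ suc)

  sum-mono-≤ : ∀ {n} {f g : Fin n → ℕ} → (∀ i → f i ≤ g i) → sum f ≤ sum g
  sum-mono-≤ {zero} le = z≤n
  sum-mono-≤ {suc n} le = +-mono-≤ (le zero) (sum-mono-≤ (le ∘ suc))

  sum-zero : ∀ {n} (f : Fin n → ℕ) → (∀ i → f i ≡ 0) → sum f ≡ 0
  sum-zero {n} f f≡0 = trans (sum-cong-≗ f≡0) (sum-replicate-zero n)

  sum-ones : ∀ n → sum {n} (λ _ → 1) ≡ n
  sum-ones zero = refl
  sum-ones (suc n) = cong suc (sum-ones n)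

  sum-≤-pointwise-≡ : ∀ {n} (f g : Fin n → ℕ) → (∀ i → g i ≤ f i) → sum f ≤ sum g → ∀ i → f i ≡ g i
  sum-≤-pointwise-≡ {suc n} f g g≤f Σf≤Σg zero =
    ≤-antisym (+-cancelʳ-≤ _ _ _ (≤-trans Σf≤Σg (+-monoʳ-≤ (g zero) (sum-mono-≤ (g≤f ∘ suc))))) (g≤f zero)
  sum-≤-pointwise-≡ {suc n} f g g≤f Σf≤Σg (suc i) =
    sum-≤-pointwise-≡ (f ∘ suc) (g ∘ suc) (g≤f ∘ suc)
      (+-cancelˡ-≤ (f zero) _ _ (≤-trans Σf≤Σg (+-monoˡ-≤ (sum (g ∘ suc)) (g≤f zero)))) i

  sum-swap-at : ∀ {n} (f g : Fin (suc n) → ℕ) (p : Fin (suc n)) → (∀ i → i ≢ p → f i ≡ g i) →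
    sum f + g p ≡ sum g + f p
  sum-swap-at f g p agree = begin
    sum f + g p                          ≡⟨ cong (_+ g p) (sum-remove {i = p} f) ⟩
    f p + sum (f ∘ punchIn p) + g p      ≡⟨ cong (λ s → f p + s + g p) (sum-cong-≗ (λ j → agree _ (punchInᵢ≢i p j))) ⟩
    f p + sum (g ∘ punchIn p) + g p      ≡⟨ swap (f p) (sum (g ∘ punchIn p)) (g p) ⟩
    g p + sum (g ∘ punchIn p) + f p      ≡⟨ cong (_+ f p) (sum-remove {i = p} g) ⟨
    sum g + f p                          ∎
    where
    open ≡-Reasoning
    swap : ∀ a s b → a + s + b ≡ b + s + a
    swap = solve-∀

  sum-⟦≟⟧ : ∀ {n} (x : Fin (suc n)) → sum (λ z → ⟦ x ≟ z ⟧) ≡ 1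
  sum-⟦≟⟧ x = begin
    sum (λ z → ⟦ x ≟ z ⟧)                            ≡⟨ sum-remove {i = x} (λ z → ⟦ x ≟ z ⟧) ⟩
    ⟦ x ≟ x ⟧ + sum (λ j → ⟦ x ≟ punchIn x j ⟧)      ≡⟨ cong₂ _+_ (⟦⟧≡1 (x ≟ x) refl) (sum-zero _ x≢punchIn) ⟩
    1                                                ∎
    where
    open ≡-Reasoning
    x≢punchIn : ∀ j → ⟦ x ≟ punchIn x j ⟧ ≡ 0
    x≢punchIn j = ⟦⟧≡0 (x ≟ punchIn x j) (punchInᵢ≢i x j ∘ sym)

  ⟦⟧+⟦⟧-positive : ∀ {p q} {P : Set p} {Q : Set q} (d : Dec P) (e : Dec Q) → 1 ≤ ⟦ d ⟧ + ⟦ e ⟧ → P ⊎ Q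
  ⟦⟧+⟦⟧-positive (yes p) e _ = inj₁ p
  ⟦⟧+⟦⟧-positive (no _) (yes q) _ = inj₂ q

  +-≡-<⇒positive : ∀ {w a c b} → w + a ≡ c + b → w < c → 1 ≤ a
  +-≡-<⇒positive {w} {zero} {c} {b} eq w<c = ⊥-elim (<-irrefl refl (≤-trans w<c c≤w))
    where
    c≤w : c ≤ w
    c≤w = ≤-trans (m≤m+n c b) (≤-reflexive (trans (sym eq) (+-identityʳ w)))
  +-≡-<⇒positive {a = suc _} _ _ = s≤s z≤n

  +-≡-positive⇒< : ∀ {w a c} → w + a ≡ c + 0 → 1 ≤ a → w < c
  +-≡-positive⇒< {w} {a} {c} eq 1≤a =
    ≤-trans (≤-reflexive (+-comm 1 w)) (≤-trans (+-monoʳ-≤ w 1≤a) (≤-reflexive (trans eq (+-identityʳ c))))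

  whenBelow : ℕ → ℕ → ℕ → ℕ
  whenBelow t m v with t <? m
  ... | yes _ = v
  ... | no _ = 0

  whenBelow-< : ∀ {t m} v → t < m → whenBelow t m v ≡ v
  whenBelow-< {t} {m} v t<m with t <? m
  ... | yes _ = refl
  ... | no t≮m = ⊥-elim (t≮m t<m)

  whenBelow-≮ : ∀ {t m} v → ¬ t < m → whenBelow t m v ≡ 0
  whenBelow-≮ {t} {m} v t≮m with t <? m
  ... | yes t<m = ⊥-elim (t≮m t<m)
  ... | no _ = refl

  whenBelow-suc : ∀ {t x} v → t ≢ x → whenBelow t (suc x) v ≡ whenBelow t x v
  whenBelow-suc {t} {x} v t≢x with t <? suc x | t <? x
  ... | yes _ | yes _ = refl
  ... | no _ | no _ = refl
  ... | yes t<1+x | no t≮x = ⊥-elim (t≮x (≤∧≢⇒< (s≤s⁻¹ t<1+x) t≢x))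
  ... | no t≮1+x | yes t<x = ⊥-elim (t≮1+x (m<n⇒m<1+n t<x))

  positive? : ℕ → ℕ → Bool
  positive? u c = does (c <? u + c)

  positive?-zero : ∀ c → positive? 0 c ≡ false
  positive?-zero c = dec-false (c <? c) (<-irrefl refl)

  positive?-≥1 : ∀ u c → 1 ≤ u → positive? u c ≡ true
  positive?-≥1 u c 1≤u = dec-true (c <? u + c) (+-monoˡ-≤ c 1≤u)

  positive?-true⇒ : ∀ u c → positive? u c ≡ true → 1 ≤ u
  positive?-true⇒ zero c eq with () ← trans (sym eq) (positive?-zero c)
  positive?-true⇒ (suc u) c eq = s≤s z≤n

  positive?-false⇒ : ∀ u c → positive? u c ≡ false → u ≡ 0
  positive?-false⇒ zero c eq = refl
  positive?-false⇒ (suc u) c eq with () ← trans (sym (positive?-≥1 (suc u) c (s≤s z≤n))) eq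

  locateAll-potential : ∀ r u u′ L → r < u → u′ + r ≡ u → r * L + (u′ ∸ 1) * L ≡ (u ∸ 1) * L
  locateAll-potential r u zero L r<u eq = ⊥-elim (<-irrefl eq r<u)
  locateAll-potential r u (suc u′) L _ eq =
    trans (sym (*-distribʳ-+ L r u′)) (cong (_* L) (trans (+-comm r u′) (cong (_∸ 1) eq)))

  ⌈log₂⌉-halve : ∀ S → 2 ≤ S → suc ⌈log₂ ⌈ S /2⌉ ⌉ ≡ ⌈log₂ S ⌉
  ⌈log₂⌉-halve S 2≤S = trans (cong suc (⌈log₂⌈n/2⌉⌉≡⌈log₂n⌉∸1 S)) (m+[n∸m]≡n 1≤⌈log₂S⌉)
    where
    1≤⌈log₂S⌉ : 1 ≤ ⌈log₂ S ⌉
    1≤⌈log₂S⌉ = subst (_≤ ⌈log₂ S ⌉) (⌈log₂2^n⌉≡n 1) (⌈log₂⌉-mono-≤ 2≤S)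

  opaque
    find : ∀ {n p} {P : Pred (Fin (suc n)) p} → Decidable P → Fin (suc n)
    find P? with any? P?
    ... | yes (z , _) = z
    ... | no _ = zero

    find-satisfies : ∀ {n p} {P : Pred (Fin (suc n)) p} (P? : Decidable P) → ¬ (∀ z → ¬ P z) → P (find P?)
    find-satisfies P? ¬none with any? P?
    ... | yes (_ , Pz) = Pz
    ... | no ¬some = ⊥-elim (¬none (λ z Pz → ¬some (z , Pz)))

  find-unique : ∀ {n p} {P : Pred (Fin (suc n)) p} (P? : Decidable P) {x} → P x → (∀ z → P z → z ≡ x) → find P? ≡ x
  find-unique P? Px unique = unique _ (find-satisfies P? (λ none → none _ Px))

  -- The cyclic group of order N

  module Cyclic (m : ℕ) where

    N : ℕ
    N = suc m

    infixl 6 _⊕_ _⊝_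
    infix 8 ⊖_

    opaque
      _⊕_ : Fin N → Fin N → Fin N
      i ⊕ j = (toℕ i + toℕ j) mod N

      ⊖_ : Fin N → Fin N
      ⊖ i = (N ∸ toℕ i) mod N

      𝟙 : Fin N
      𝟙 = 1 mod N

      toℕ-⊕ : ∀ i j → toℕ (i ⊕ j) ≡ (toℕ i + toℕ j) % N
      toℕ-⊕ i j = toℕ-fromℕ< (m%n<n (toℕ i + toℕ j) N)

      toℕ-⊖ : ∀ i → toℕ (⊖ i) ≡ (N ∸ toℕ i) % N
      toℕ-⊖ i = toℕ-fromℕ< (m%n<n (N ∸ toℕ i) N)

      toℕ-𝟙 : 1 < N → toℕ 𝟙 ≡ 1
      toℕ-𝟙 1<N = trans (toℕ-fromℕ< (m%n<n 1 N)) (m<n⇒m%n≡m 1<N)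

      ⊕-comm : ∀ i j → i ⊕ j ≡ j ⊕ i
      ⊕-comm i j = cong (_mod N) (+-comm (toℕ i) (toℕ j))

    𝟘 : Fin N
    𝟘 = zero

    _⊝_ : Fin N → Fin N → Fin N
    i ⊝ j = i ⊕ ⊖ j

    %-absorbˡ : ∀ a b → (a % N + b) % N ≡ (a + b) % N
    %-absorbˡ a b = begin
      (a % N + b) % N          ≡⟨ %-distribˡ-+ (a % N) b N ⟩
      (a % N % N + b % N) % N  ≡⟨ cong (λ x → (x + b % N) % N) (m%n%n≡m%n a N) ⟩
      (a % N + b % N) % N      ≡⟨ %-distribˡ-+ a b N ⟨
      (a + b) % N              ∎
      where open ≡-Reasoning

    %-absorbʳ : ∀ a b → (a + b % N) % N ≡ (a + b) % N
    %-absorbʳ a b = begin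
      (a + b % N) % N  ≡⟨ cong (_% N) (+-comm a (b % N)) ⟩
      (b % N + a) % N  ≡⟨ %-absorbˡ b a ⟩
      (b + a) % N      ≡⟨ cong (_% N) (+-comm b a) ⟩
      (a + b) % N      ∎
      where open ≡-Reasoning

    ⊕-assoc : ∀ i j k → (i ⊕ j) ⊕ k ≡ i ⊕ (j ⊕ k)
    ⊕-assoc i j k = toℕ-injective (begin
      toℕ ((i ⊕ j) ⊕ k)                  ≡⟨ toℕ-⊕ (i ⊕ j) k ⟩
      (toℕ (i ⊕ j) + toℕ k) % N          ≡⟨ cong (λ x → (x + toℕ k) % N) (toℕ-⊕ i j) ⟩
      ((toℕ i + toℕ j) % N + toℕ k) % N  ≡⟨ %-absorbˡ (toℕ i + toℕ j) (toℕ k) ⟩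
      (toℕ i + toℕ j + toℕ k) % N        ≡⟨ cong (_% N) (+-assoc (toℕ i) (toℕ j) (toℕ k)) ⟩
      (toℕ i + (toℕ j + toℕ k)) % N      ≡⟨ %-absorbʳ (toℕ i) (toℕ j + toℕ k) ⟨
      (toℕ i + (toℕ j + toℕ k) % N) % N  ≡⟨ cong (λ x → (toℕ i + x) % N) (toℕ-⊕ j k) ⟨
      (toℕ i + toℕ (j ⊕ k)) % N          ≡⟨ toℕ-⊕ i (j ⊕ k) ⟨
      toℕ (i ⊕ (j ⊕ k))                  ∎)
      where open ≡-Reasoning

    ⊕-identityˡ : ∀ i → 𝟘 ⊕ i ≡ i
    ⊕-identityˡ i = toℕ-injective (trans (toℕ-⊕ 𝟘 i) (m<n⇒m%n≡m (toℕ<n i)))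

    ⊕-identityʳ : ∀ i → i ⊕ 𝟘 ≡ i
    ⊕-identityʳ i = trans (⊕-comm i 𝟘) (⊕-identityˡ i)

    ⊕-inverseʳ : ∀ i → i ⊕ ⊖ i ≡ 𝟘
    ⊕-inverseʳ i = toℕ-injective (begin
      toℕ (i ⊕ ⊖ i)                  ≡⟨ toℕ-⊕ i (⊖ i) ⟩
      (toℕ i + toℕ (⊖ i)) % N        ≡⟨ cong (λ x → (toℕ i + x) % N) (toℕ-⊖ i) ⟩
      (toℕ i + (N ∸ toℕ i) % N) % N  ≡⟨ %-absorbʳ (toℕ i) (N ∸ toℕ i) ⟩
      (toℕ i + (N ∸ toℕ i)) % N      ≡⟨ cong (_% N) (m+[n∸m]≡n (<⇒≤ (toℕ<n i))) ⟩
      N % N                          ≡⟨ n%n≡0 N ⟩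
      0                              ∎)
      where open ≡-Reasoning

    ⊕-inverseˡ : ∀ i → ⊖ i ⊕ i ≡ 𝟘
    ⊕-inverseˡ i = trans (⊕-comm (⊖ i) i) (⊕-inverseʳ i)

    ⊕-isAbelianGroup : IsAbelianGroup _≡_ _⊕_ 𝟘 ⊖_
    ⊕-isAbelianGroup = record
      { isGroup = record
        { isMonoid = record
          { isSemigroup = record
            { isMagma = record { isEquivalence = isEquivalence ; ∙-cong = cong₂ _⊕_ }
            ; assoc = ⊕-assoc }
          ; identity = ⊕-identityˡ , ⊕-identityʳ }
        ; inverse = ⊕-inverseˡ , ⊕-inverseʳ
        ; ⁻¹-cong = cong ⊖_ }
      ; comm = ⊕-comm }

    ⊕-abelianGroup : AbelianGroup _ _
    ⊕-abelianGroup = record { isAbelianGroup = ⊕-isAbelianGroup }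

    open AbelianGroupProperties ⊕-abelianGroup public
      using (⁻¹-∙-comm; //-rightDividesˡ; //-rightDividesʳ; \\-leftDividesˡ; \\-leftDividesʳ; x∙y⁻¹≈ε⇒x≈y)
      renaming (∙-cancelˡ to ⊕-cancelˡ; ∙-cancelʳ to ⊕-cancelʳ)

    ⊝-⊕-cancel : ∀ a b → a ⊝ b ⊕ b ≡ a
    ⊝-⊕-cancel a b = //-rightDividesˡ b a

    ⊕-⊝-cancel : ∀ a b → a ⊕ b ⊝ b ≡ a
    ⊕-⊝-cancel a b = //-rightDividesʳ b a

    ⊕-⊝-cancelˡ : ∀ a b → a ⊕ (b ⊝ a) ≡ b
    ⊕-⊝-cancelˡ a b = trans (⊕-comm a (b ⊝ a)) (⊝-⊕-cancel b a)

    ⊝-⊕-comm : ∀ a b c → a ⊝ b ⊕ c ≡ a ⊕ c ⊝ b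
    ⊝-⊕-comm a b c = begin
      a ⊕ ⊖ b ⊕ c    ≡⟨ ⊕-assoc a (⊖ b) c ⟩
      a ⊕ (⊖ b ⊕ c)  ≡⟨ cong (a ⊕_) (⊕-comm (⊖ b) c) ⟩
      a ⊕ (c ⊕ ⊖ b)  ≡⟨ ⊕-assoc a c (⊖ b) ⟨
      a ⊕ c ⊕ ⊖ b    ∎
      where open ≡-Reasoning

    ⊝-⊕-assoc : ∀ a b c → a ⊝ (b ⊕ c) ≡ a ⊝ b ⊝ c
    ⊝-⊕-assoc a b c = begin
      a ⊕ ⊖ (b ⊕ c)    ≡⟨ cong (a ⊕_) (⁻¹-∙-comm b c) ⟨
      a ⊕ (⊖ b ⊕ ⊖ c)  ≡⟨ ⊕-assoc a (⊖ b) (⊖ c) ⟨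
      a ⊕ ⊖ b ⊕ ⊖ c    ∎
      where open ≡-Reasoning

    ⊝-≡-𝟘 : ∀ {a b} → a ⊝ b ≡ 𝟘 → a ≡ b
    ⊝-≡-𝟘 = x∙y⁻¹≈ε⇒x≈y _ _

    toℕ-⊕𝟙 : ∀ j → suc (toℕ j) < N → toℕ (j ⊕ 𝟙) ≡ suc (toℕ j)
    toℕ-⊕𝟙 j lt = begin
      toℕ (j ⊕ 𝟙)          ≡⟨ toℕ-⊕ j 𝟙 ⟩
      (toℕ j + toℕ 𝟙) % N  ≡⟨ cong (λ x → (toℕ j + x) % N) (toℕ-𝟙 (≤-trans (s≤s (s≤s z≤n)) lt)) ⟩
      (toℕ j + 1) % N      ≡⟨ cong (_% N) (+-comm (toℕ j) 1) ⟩
      suc (toℕ j) % N      ≡⟨ m<n⇒m%n≡m lt ⟩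
      suc (toℕ j)          ∎
      where open ≡-Reasoning

    toℕ-⊝𝟙 : 1 < N → ∀ x → x ≢ 𝟘 → suc (toℕ (x ⊝ 𝟙)) ≡ toℕ x
    toℕ-⊝𝟙 1<N x x≢𝟘 with <-cmp (suc (toℕ (x ⊝ 𝟙))) N
    ... | tri< lt _ _ = trans (sym (toℕ-⊕𝟙 (x ⊝ 𝟙) lt)) (cong toℕ (⊝-⊕-cancel x 𝟙))
    ... | tri≈ _ eq _ = ⊥-elim (x≢𝟘 (trans (sym (⊝-⊕-cancel x 𝟙)) (toℕ-injective wraps)))
      where
      wraps : toℕ (x ⊝ 𝟙 ⊕ 𝟙) ≡ 0
      wraps = begin
        toℕ (x ⊝ 𝟙 ⊕ 𝟙)                ≡⟨ toℕ-⊕ (x ⊝ 𝟙) 𝟙 ⟩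
        (toℕ (x ⊝ 𝟙) + toℕ 𝟙) % N      ≡⟨ cong (λ t → (toℕ (x ⊝ 𝟙) + t) % N) (toℕ-𝟙 1<N) ⟩
        (toℕ (x ⊝ 𝟙) + 1) % N          ≡⟨ cong (_% N) (trans (+-comm (toℕ (x ⊝ 𝟙)) 1) eq) ⟩
        N % N                          ≡⟨ n%n≡0 N ⟩
        0                              ∎
        where open ≡-Reasoning
    ... | tri> _ _ gt = ⊥-elim (<-irrefl refl (≤-trans gt (toℕ<n (x ⊝ 𝟙))))

    translation : Fin N → Permutation′ N
    translation a = permutation (a ⊕_) (⊖ a ⊕_) (\\-leftDividesˡ a) (\\-leftDividesʳ a)

    sum-translate : ∀ (f : Fin N → ℕ) a → sum f ≡ sum (λ j → f (a ⊕ j))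
    sum-translate f a = sum-permute f (translation a)

  -- Protocols and binary search

  module Protocols (n : ℕ) where

    Code : Set
    Code = Vec (Fin n) n

    -- Strategies that return a value, so that they can be sequenced with _>>=_.
    data Protocol (A : Set) : Set where
      done  : A → Protocol A
      query : (x : Code) → IsPerm x → (ℕ → Protocol A) → Protocol A

    infixl 1 _>>=_
    _>>=_ : ∀ {A B : Set} → Protocol A → (A → Protocol B) → Protocol B
    done a >>= f = f a
    query x px k >>= f = query x px (λ r → k r >>= f)

    run : ∀ {A : Set} → Code → Protocol A → A
    run y (done a) = a
    run y (query x _ k) = run y (k (black x y))

    cost : ∀ {A : Set} → Code → Protocol A → ℕ
    cost y (done a) = 0
    cost y (query x _ k) = suc (cost y (k (black x y)))

    toStrategy : ∀ {A : Set} → Protocol A → Strategy n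
    toStrategy (done a) = stop
    toStrategy (query x px k) = ask x px (λ r → toStrategy (k r))

    run->>= : ∀ {A B : Set} y (p : Protocol A) (f : A → Protocol B) → run y (p >>= f) ≡ run y (f (run y p))
    run->>= y (done a) f = refl
    run->>= y (query x _ k) f = run->>= y (k (black x y)) f

    cost->>= : ∀ {A B : Set} y (p : Protocol A) (f : A → Protocol B) →
      cost y (p >>= f) ≡ cost y p + cost y (f (run y p))
    cost->>= y (done a) f = refl
    cost->>= y (query x _ k) f = cong suc (cost->>= y (k (black x y)) f)

    run-pipeline : ∀ {A B C D : Set} y (p : Protocol A) (q : Protocol B) (r : A → B → Protocol C) (f : C → D) →
      run y (p >>= λ a → q >>= λ b → r a b >>= λ c → done (f c)) ≡ f (run y (r (run y p) (run y q)))
    run-pipeline y p q r f = begin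
      run y (p >>= λ a → q >>= λ b → r a b >>= λ c → done (f c))  ≡⟨ run->>= y p (λ a → q >>= λ b → r a b >>= λ c → done (f c)) ⟩
      run y (q >>= λ b → r (run y p) b >>= λ c → done (f c))      ≡⟨ run->>= y q (λ b → r (run y p) b >>= λ c → done (f c)) ⟩
      run y (r (run y p) (run y q) >>= λ c → done (f c))          ≡⟨ run->>= y (r (run y p) (run y q)) (λ c → done (f c)) ⟩
      f (run y (r (run y p) (run y q)))                          ∎
      where open ≡-Reasoning

    cost-pipeline : ∀ {A B C D : Set} y (p : Protocol A) (q : Protocol B) (r : A → B → Protocol C) (f : C → D) →
      cost y (p >>= λ a → q >>= λ b → r a b >>= λ c → done (f c)) ≡ cost y p + (cost y q + cost y (r (run y p) (run y q)))
    cost-pipeline y p q r f = begin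
      cost y (p >>= λ a → q >>= λ b → r a b >>= λ c → done (f c))
        ≡⟨ cost->>= y p (λ a → q >>= λ b → r a b >>= λ c → done (f c)) ⟩
      cost y p + cost y (q >>= λ b → r (run y p) b >>= λ c → done (f c))
        ≡⟨ cong (cost y p +_) (cost->>= y q (λ b → r (run y p) b >>= λ c → done (f c))) ⟩
      cost y p + (cost y q + cost y (r (run y p) (run y q) >>= λ c → done (f c)))
        ≡⟨ cong (λ t → cost y p + (cost y q + t)) (trans (cost->>= y (r (run y p) (run y q)) (λ c → done (f c))) (+-identityʳ _)) ⟩
      cost y p + (cost y q + cost y (r (run y p) (run y q)))
        ∎
      where open ≡-Reasoning

    length-transcript : ∀ {A : Set} y (p : Protocol A) → length (transcript (toStrategy p) y) ≡ cost y p
    length-transcript y (done a) = refl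
    length-transcript y (query x _ k) = cong suc (length-transcript y (k (black x y)))

    run-consistent : ∀ {A : Set} y z (p : Protocol A) → Consistent z (transcript (toStrategy p) y) → run z p ≡ run y p
    run-consistent y z (done a) _ = refl
    run-consistent y z (query x _ k) (same ∷ rest) rewrite same = run-consistent y z (k (black x y)) rest

    Decodes : Protocol (Fin n → Fin n) → Set
    Decodes p = ∀ y → IsPerm y → ∀ i → run y p i ≡ lookup y i

    decodes⇒determines : ∀ p → Decodes p → ∀ y → IsPerm y → Determines (toStrategy p) y
    decodes⇒determines p decodes y y-perm z z-perm consistent = begin
      z                            ≡⟨ tabulate∘lookup z ⟨
      tabulate (lookup z)          ≡⟨ tabulate-cong z≗y ⟩
      tabulate (lookup y)          ≡⟨ tabulate∘lookup y ⟩
      y                            ∎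
      where
      open ≡-Reasoning
      z≗y : ∀ i → lookup z i ≡ lookup y i
      z≗y i = trans (sym (decodes z z-perm i))
                (trans (cong (λ f → f i) (run-consistent y z p consistent)) (decodes y y-perm i))

    askAll : ∀ {m} → (Fin m → Protocol ℕ) → Protocol (Fin m → ℕ)
    askAll {zero} f = done (λ ())
    askAll {suc m} f = f zero >>= λ a → askAll (f ∘ suc) >>= λ g → done (a ◂ g)

    run-askAll : ∀ y {m} (f : Fin m → Protocol ℕ) i → run y (askAll f) i ≡ run y (f i)
    run-askAll y {suc m} f i
      rewrite run->>= y (f zero) (λ a → askAll (f ∘ suc) >>= λ g → done (a ◂ g))
            | run->>= y (askAll (f ∘ suc)) (λ g → done (run y (f zero) ◂ g))
      with i
    ... | zero = refl
    ... | suc i = run-askAll y (f ∘ suc) i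

    cost-askAll : ∀ y {m} (f : Fin m → Protocol ℕ) → (∀ i → cost y (f i) ≡ 1) → cost y (askAll f) ≡ m
    cost-askAll y {zero} f _ = refl
    cost-askAll y {suc m} f cost≡1
      rewrite cost->>= y (f zero) (λ a → askAll (f ∘ suc) >>= λ g → done (a ◂ g))
            | cost->>= y (askAll (f ∘ suc)) (λ g → done (run y (f zero) ◂ g))
            | cost≡1 zero | cost-askAll y (f ∘ suc) (cost≡1 ∘ suc) = cong suc (+-identityʳ m)

    StepIn : (p : ℕ → Bool) (lo S x : ℕ) → Set
    StepIn p lo S x = (lo ≤ x) × (x < lo + S) × (p x ≡ false) × (p (suc x) ≡ true)

    Realises : Code → (ℕ → Protocol Bool) → (ℕ → Bool) → Set
    Realises y test p = ∀ m → run y (test m) ≡ p m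

    binarySearch : (fuel lo S : ℕ) → (ℕ → Protocol Bool) → Protocol ℕ
    binarySearch-continue : (fuel lo S : ℕ) → (ℕ → Protocol Bool) → Bool → Protocol ℕ
    binarySearch zero lo S test = done lo
    binarySearch (suc fuel) lo zero test = done lo
    binarySearch (suc fuel) lo (suc zero) test = done lo
    binarySearch (suc fuel) lo S@(suc (suc _)) test =
      test (lo + ⌊ S /2⌋) >>= binarySearch-continue fuel lo S test
    binarySearch-continue fuel lo S test true = binarySearch fuel lo ⌊ S /2⌋ test
    binarySearch-continue fuel lo S test false = binarySearch fuel (lo + ⌊ S /2⌋) ⌈ S /2⌉ test

    module _ {y : Code} {test : ℕ → Protocol Bool} {p : ℕ → Bool} (realises : Realises y test p) where

      private
        step-at-lo : ∀ lo → p lo ≡ false → p (lo + 1) ≡ true → StepIn p lo 1 lo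
        step-at-lo lo p-lo p-lo+1 =
          ≤-refl , subst (lo <_) (+-comm 1 lo) (n<1+n lo) , p-lo , trans (cong p (+-comm 1 lo)) p-lo+1

      binarySearch-finds-step : ∀ fuel lo S → p lo ≡ false → p (lo + S) ≡ true → 1 ≤ S → S ≤ suc fuel →
        StepIn p lo S (run y (binarySearch fuel lo S test))
      binarySearch-finds-step zero lo (suc zero) p-lo p-hi _ _ = step-at-lo lo p-lo p-hi
      binarySearch-finds-step zero lo (suc (suc _)) _ _ _ (s≤s ())
      binarySearch-finds-step (suc fuel) lo (suc zero) p-lo p-hi _ _ = step-at-lo lo p-lo p-hi
      binarySearch-finds-step (suc fuel) lo S@(suc (suc S′)) p-lo p-hi _ S≤fuel
        rewrite run->>= y (test (lo + ⌊ S /2⌋)) (binarySearch-continue fuel lo S test)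
              | realises (lo + ⌊ S /2⌋)
        with p (lo + ⌊ S /2⌋) in p-mid
      ... | true =
        let (lo≤x , x<mid , p-x , p-x+1) =
              binarySearch-finds-step fuel lo ⌊ S /2⌋ p-lo p-mid (s≤s z≤n) (≤-trans (s≤s (⌊n/2⌋≤n S′)) (s≤s⁻¹ S≤fuel))
        in lo≤x , <-≤-trans x<mid (+-monoʳ-≤ lo (⌊n/2⌋≤n S)) , p-x , p-x+1
      ... | false =
        let (mid≤x , x<hi , p-x , p-x+1) =
              binarySearch-finds-step fuel (lo + ⌊ S /2⌋) ⌈ S /2⌉ p-mid (trans (cong p halves) p-hi)
                (s≤s z≤n) (≤-trans (s≤s⁻¹ (⌈n/2⌉<n S′)) (s≤s⁻¹ S≤fuel))
        in ≤-trans (m≤m+n lo ⌊ S /2⌋) mid≤x , subst (run y (binarySearch fuel (lo + ⌊ S /2⌋) ⌈ S /2⌉ test) <_) halves x<hi , p-x , p-x+1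
        where
        halves : lo + ⌊ S /2⌋ + ⌈ S /2⌉ ≡ lo + S
        halves = trans (+-assoc lo ⌊ S /2⌋ ⌈ S /2⌉) (cong (lo +_) (⌊n/2⌋+⌈n/2⌉≡n S))

    binarySearch-cost : ∀ {y test} → (∀ m → cost y (test m) ≤ 1) →
      ∀ fuel lo S → cost y (binarySearch fuel lo S test) ≤ ⌈log₂ S ⌉
    binarySearch-cost _ zero lo S = z≤n
    binarySearch-cost _ (suc fuel) lo zero = z≤n
    binarySearch-cost _ (suc fuel) lo (suc zero) = z≤n
    binarySearch-cost {y} {test} cost-test (suc fuel) lo S@(suc (suc _))
      rewrite cost->>= y (test (lo + ⌊ S /2⌋)) (binarySearch-continue fuel lo S test) =
      ≤-trans (+-mono-≤ (cost-test (lo + ⌊ S /2⌋)) (continue-cost (run y (test (lo + ⌊ S /2⌋)))))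
              (≤-reflexive (⌈log₂⌉-halve S (s≤s (s≤s z≤n))))
      where
      continue-cost : ∀ b → cost y (binarySearch-continue fuel lo S test b) ≤ ⌈log₂ ⌈ S /2⌉ ⌉
      continue-cost true = ≤-trans (binarySearch-cost cost-test fuel lo ⌊ S /2⌋) (⌈log₂⌉-mono-≤ (⌊n/2⌋≤⌈n/2⌉ S))
      continue-cost false = binarySearch-cost cost-test fuel (lo + ⌊ S /2⌋) ⌈ S /2⌉

  -- Probes and shifts

  module Probes (k : ℕ) where
    open Cyclic k
    open Protocols N

    cycle : ℕ → Fin N → Fin N
    cycle m j with <-cmp (toℕ j) m
    ... | tri< _ _ _ = j ⊕ 𝟙
    ... | tri≈ _ _ _ = 𝟘
    ... | tri> _ _ _ = j

    cycle-< : ∀ m j → toℕ j < m → cycle m j ≡ j ⊕ 𝟙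
    cycle-< m j lt with <-cmp (toℕ j) m
    ... | tri< _ _ _ = refl
    ... | tri≈ ¬lt _ _ = ⊥-elim (¬lt lt)
    ... | tri> ¬lt _ _ = ⊥-elim (¬lt lt)

    cycle-≡ : ∀ m j → toℕ j ≡ m → cycle m j ≡ 𝟘
    cycle-≡ m j eq with <-cmp (toℕ j) m
    ... | tri< _ ¬eq _ = ⊥-elim (¬eq eq)
    ... | tri≈ _ _ _ = refl
    ... | tri> _ ¬eq _ = ⊥-elim (¬eq eq)

    cycle-> : ∀ m j → m < toℕ j → cycle m j ≡ j
    cycle-> m j gt with <-cmp (toℕ j) m
    ... | tri< _ _ ¬gt = ⊥-elim (¬gt gt)
    ... | tri≈ _ _ ¬gt = ⊥-elim (¬gt gt)
    ... | tri> _ _ _ = refl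

    cycle-zero : ∀ j → cycle 0 j ≡ j
    cycle-zero zero = cycle-≡ 0 zero refl
    cycle-zero (suc j) = cycle-> 0 (suc j) (s≤s z≤n)

    private
      toℕ-⊕𝟙-below : ∀ i j → toℕ i < toℕ j → toℕ (i ⊕ 𝟙) ≡ suc (toℕ i)
      toℕ-⊕𝟙-below i j i<j = toℕ-⊕𝟙 i (≤-<-trans i<j (toℕ<n j))

      ⊕𝟙≢𝟘 : ∀ i j → toℕ i < toℕ j → i ⊕ 𝟙 ≢ 𝟘
      ⊕𝟙≢𝟘 i j i<j eq = 1+n≢0 (trans (sym (toℕ-⊕𝟙-below i j i<j)) (cong toℕ eq))

      ⊕𝟙≢above : ∀ m i j → toℕ i < m → m < toℕ j → i ⊕ 𝟙 ≢ j
      ⊕𝟙≢above m i j i<m m<j eq =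
        <⇒≱ m<j (subst (_≤ m) (trans (sym (toℕ-⊕𝟙-below i j (<-trans′ i<m m<j))) (cong toℕ eq)) i<m)
        where
        <-trans′ : toℕ i < m → m < toℕ j → toℕ i < toℕ j
        <-trans′ p q = ≤-trans p (<⇒≤ q)

      𝟘≢above : ∀ m j → m < toℕ j → 𝟘 ≢ j
      𝟘≢above m j m<j eq = <⇒≢ (≤-trans (s≤s z≤n) m<j) (cong toℕ eq)

    cycle-injective : ∀ m i j → cycle m i ≡ cycle m j → i ≡ j
    cycle-injective m i j eq with <-cmp (toℕ i) m | <-cmp (toℕ j) m
    ... | tri< _ _ _    | tri< _ _ _    = ⊕-cancelʳ 𝟙 i j eq
    ... | tri< i<m _ _  | tri≈ _ j≡m _  = ⊥-elim (⊕𝟙≢𝟘 i j (subst (toℕ i <_) (sym j≡m) i<m) eq)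
    ... | tri< i<m _ _  | tri> _ _ m<j  = ⊥-elim (⊕𝟙≢above m i j i<m m<j eq)
    ... | tri≈ _ i≡m _  | tri< j<m _ _  = ⊥-elim (⊕𝟙≢𝟘 j i (subst (toℕ j <_) (sym i≡m) j<m) (sym eq))
    ... | tri≈ _ i≡m _  | tri≈ _ j≡m _  = toℕ-injective (trans i≡m (sym j≡m))
    ... | tri≈ _ _ _    | tri> _ _ m<j  = ⊥-elim (𝟘≢above m j m<j eq)
    ... | tri> _ _ m<i  | tri< j<m _ _  = ⊥-elim (⊕𝟙≢above m j i j<m m<i (sym eq))
    ... | tri> _ _ m<i  | tri≈ _ _ _    = ⊥-elim (𝟘≢above m i m<i (sym eq))
    ... | tri> _ _ _    | tri> _ _ _    = eq

    probe : (w : Fin N) (m : ℕ) (a : Fin N) → Code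
    probe w m a = tabulate (λ i → w ⊕ cycle m (i ⊝ a))

    probe-isPerm : ∀ w m a → IsPerm (probe w m a)
    probe-isPerm w m a i j eq =
      ⊕-cancelʳ (⊖ a) i j (cycle-injective m (i ⊝ a) (j ⊝ a) (⊕-cancelˡ w _ _ eq′))
      where
      eq′ : w ⊕ cycle m (i ⊝ a) ≡ w ⊕ cycle m (j ⊝ a)
      eq′ = trans (sym (lookup∘tabulate (λ i → w ⊕ cycle m (i ⊝ a)) i))
              (trans eq (lookup∘tabulate (λ i → w ⊕ cycle m (i ⊝ a)) j))

    askProbe : Fin N → ℕ → Fin N → Protocol ℕ
    askProbe w m a = query (probe w m a) (probe-isPerm w m a) done

    run-askProbe : ∀ y w m a → run y (askProbe w m a) ≡ sum (λ j → ⟦ w ⊕ cycle m j ≟ lookup y (a ⊕ j) ⟧)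
    run-askProbe y w m a = begin
      black (probe w m a) y
        ≡⟨ length-filter-tabulate (λ i → lookup (probe w m a) i ≟ lookup y i) (λ i → i) ⟩
      sum (λ i → ⟦ lookup (probe w m a) i ≟ lookup y i ⟧)
        ≡⟨ sum-cong-≗ (λ i → cong (λ x → ⟦ x ≟ lookup y i ⟧) (lookup∘tabulate (λ i → w ⊕ cycle m (i ⊝ a)) i)) ⟩
      sum (λ i → ⟦ w ⊕ cycle m (i ⊝ a) ≟ lookup y i ⟧)
        ≡⟨ sum-translate (λ i → ⟦ w ⊕ cycle m (i ⊝ a) ≟ lookup y i ⟧) a ⟩
      sum (λ j → ⟦ w ⊕ cycle m (a ⊕ j ⊝ a) ≟ lookup y (a ⊕ j) ⟧)
        ≡⟨ sum-cong-≗ (λ j → cong (λ t → ⟦ w ⊕ cycle m t ≟ lookup y (a ⊕ j) ⟧) (⊕-⊝-cancelʳ a j)) ⟩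
      sum (λ j → ⟦ w ⊕ cycle m j ≟ lookup y (a ⊕ j) ⟧)
        ∎
      where
      open ≡-Reasoning
      ⊕-⊝-cancelʳ : ∀ a j → a ⊕ j ⊝ a ≡ j
      ⊕-⊝-cancelʳ a j = trans (cong (_⊝ a) (⊕-comm a j)) (⊕-⊝-cancel j a)

    module Shifts (y : Code) where

      shift : Fin N → Fin N
      shift i = lookup y i ⊝ i

      ⊕-shift : ∀ i → i ⊕ shift i ≡ lookup y i
      ⊕-shift i = ⊕-⊝-cancelˡ i (lookup y i)

      ⟦hit⟧≡⟦shift⟧ : ∀ p c x → x ≡ c ⊕ p → ⟦ x ≟ lookup y p ⟧ ≡ ⟦ shift p ≟ c ⟧
      ⟦hit⟧≡⟦shift⟧ p c x refl = ⟦⟧-cong (c ⊕ p ≟ lookup y p) (shift p ≟ c) hit⇒shift shift⇒hit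
        where
        hit⇒shift : c ⊕ p ≡ lookup y p → shift p ≡ c
        hit⇒shift eq = trans (cong (_⊝ p) (sym eq)) (⊕-⊝-cancel c p)
        shift⇒hit : shift p ≡ c → c ⊕ p ≡ lookup y p
        shift⇒hit eq = trans (cong (_⊕ p) (sym eq)) (⊝-⊕-cancel (lookup y p) p)

      classSize : Fin N → ℕ
      classSize c = sum (λ i → ⟦ shift i ≟ c ⟧)

      run-askProbe-0 : ∀ c → run y (askProbe c 0 𝟘) ≡ classSize c
      run-askProbe-0 c = trans (run-askProbe y c 0 𝟘) (sum-cong-≗ hit)
        where
        hit : ∀ j → ⟦ c ⊕ cycle 0 j ≟ lookup y (𝟘 ⊕ j) ⟧ ≡ ⟦ shift j ≟ c ⟧
        hit j rewrite ⊕-identityˡ j | cycle-zero j = ⟦hit⟧≡⟦shift⟧ j c (c ⊕ j) refl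

      sum-classSize : sum classSize ≡ N
      sum-classSize = begin
        sum (λ c → sum (λ i → ⟦ shift i ≟ c ⟧))  ≡⟨ ∑-comm (λ c i → ⟦ shift i ≟ c ⟧) ⟩
        sum (λ i → sum (λ c → ⟦ shift i ≟ c ⟧))  ≡⟨ sum-cong-≗ (λ i → sum-⟦≟⟧ (shift i)) ⟩
        sum {N} (λ _ → 1)                        ≡⟨ sum-ones N ⟩
        N                                        ∎
        where open ≡-Reasoning

  -- The decoder for n ≥ 3

  module Decoder (m : ℕ) where
    open Cyclic (suc (suc m)) public
    open Protocols N public
    open Probes (suc (suc m)) public

    1<N : 1 < N
    1<N = s≤s (s≤s z≤n)

    𝟙≢𝟘 : 𝟙 ≢ 𝟘
    𝟙≢𝟘 eq = 1+n≢0 (trans (sym (toℕ-𝟙 1<N)) (cong toℕ eq))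

    suc-zero≡𝟙 : Fin.suc zero ≡ 𝟙
    suc-zero≡𝟙 = toℕ-injective (sym (toℕ-𝟙 1<N))

    ≢⊕𝟙 : ∀ z → z ≢ z ⊕ 𝟙
    ≢⊕𝟙 z eq = 𝟙≢𝟘 (⊕-cancelˡ z 𝟙 𝟘 (trans (sym eq) (sym (⊕-identityʳ z))))

    ≢⊝𝟙 : ∀ z → z ≢ z ⊝ 𝟙
    ≢⊝𝟙 z eq = ≢⊕𝟙 (z ⊝ 𝟙) (trans (sym eq) (sym (⊝-⊕-cancel z 𝟙)))

    -- This is where N ≥ 3 is needed.
    ≢⊕𝟙⊕𝟙 : ∀ z → z ≢ z ⊕ 𝟙 ⊕ 𝟙
    ≢⊕𝟙⊕𝟙 z eq = 1+n≢0 (trans (sym toℕ-𝟙⊕𝟙) (cong toℕ 𝟙⊕𝟙≡𝟘))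
      where
      toℕ-𝟙⊕𝟙 : toℕ (𝟙 ⊕ 𝟙) ≡ 2
      toℕ-𝟙⊕𝟙 = trans (toℕ-⊕𝟙 𝟙 (subst (λ x → suc x < N) (sym (toℕ-𝟙 1<N)) (s≤s (s≤s (s≤s z≤n)))))
                       (cong suc (toℕ-𝟙 1<N))
      𝟙⊕𝟙≡𝟘 : 𝟙 ⊕ 𝟙 ≡ 𝟘
      𝟙⊕𝟙≡𝟘 = ⊕-cancelˡ z (𝟙 ⊕ 𝟙) 𝟘 (trans (sym (⊕-assoc z 𝟙 𝟙)) (trans (sym eq) (sym (⊕-identityʳ z))))

    ≢⊝𝟙⊝𝟙 : ∀ z → z ≢ z ⊝ 𝟙 ⊝ 𝟙
    ≢⊝𝟙⊝𝟙 z eq = ≢⊕𝟙⊕𝟙 (z ⊝ 𝟙 ⊝ 𝟙) (trans (sym eq) (sym back))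
      where
      back : z ⊝ 𝟙 ⊝ 𝟙 ⊕ 𝟙 ⊕ 𝟙 ≡ z
      back = trans (cong (_⊕ 𝟙) (⊝-⊕-cancel (z ⊝ 𝟙) 𝟙)) (⊝-⊕-cancel z 𝟙)

    toℕ-⊝-⊕𝟙 : ∀ c k → c ≢ k → suc (toℕ (c ⊝ (k ⊕ 𝟙))) ≡ toℕ (c ⊝ k)
    toℕ-⊝-⊕𝟙 c k c≢k = trans (cong (λ d → suc (toℕ d)) (⊝-⊕-assoc c k 𝟙)) (toℕ-⊝𝟙 1<N (c ⊝ k) (c≢k ∘ ⊝-≡-𝟘))

    IsFirstShift : (c W : Fin N → ℕ) → Fin N → Set
    IsFirstShift c W z = W z < c z × c (z ⊝ 𝟙) < W (z ⊝ 𝟙)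

    IsSecondShift : (c W : Fin N → ℕ) → Fin N → Set
    IsSecondShift c W z = W z < c z × c (z ⊕ 𝟙) < W (z ⊕ 𝟙)

    isFirstShift? : ∀ c W → Decidable (IsFirstShift c W)
    isFirstShift? c W z = W z <? c z ×-dec c (z ⊝ 𝟙) <? W (z ⊝ 𝟙)

    isSecondShift? : ∀ c W → Decidable (IsSecondShift c W)
    isSecondShift? c W z = W z <? c z ×-dec c (z ⊕ 𝟙) <? W (z ⊕ 𝟙)

    firstShift : (c W : Fin N → ℕ) → Fin N
    firstShift c W = find (isFirstShift? c W)

    secondShift : (c W : Fin N → ℕ) → Fin N
    secondShift c W = find (isSecondShift? c W)

    -- c counts the shifts; W counts them after the shift α of position 0 is moved to α ⊕ 𝟙
    -- and the shift β of position 1 to β ⊝ 𝟙.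
    module Balance (c W : Fin N → ℕ) (α β : Fin N) (β≢α⊝𝟙 : β ≢ α ⊝ 𝟙)
      (balance : ∀ z → W z + (⟦ α ≟ z ⟧ + ⟦ β ≟ z ⟧) ≡ c z + (⟦ α ≟ z ⊕ 𝟙 ⟧ + ⟦ β ≟ z ⊝ 𝟙 ⟧)) where

      private
        α≢β⊕𝟙 : α ≢ β ⊕ 𝟙
        α≢β⊕𝟙 eq = β≢α⊝𝟙 (trans (sym (⊕-⊝-cancel β 𝟙)) (cong (_⊝ 𝟙) (sym eq)))

      dip⇒shift : ∀ z → W z < c z → α ≡ z ⊎ β ≡ z
      dip⇒shift z lt = ⟦⟧+⟦⟧-positive (α ≟ z) (β ≟ z) (+-≡-<⇒positive (balance z) lt)

      peak⇒moved : ∀ z → c z < W z → α ≡ z ⊕ 𝟙 ⊎ β ≡ z ⊝ 𝟙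
      peak⇒moved z lt = ⟦⟧+⟦⟧-positive (α ≟ z ⊕ 𝟙) (β ≟ z ⊝ 𝟙) (+-≡-<⇒positive (sym (balance z)) lt)

      private
        dip-at : ∀ z → α ≡ z ⊎ β ≡ z → α ≢ z ⊕ 𝟙 → β ≢ z ⊝ 𝟙 → W z < c z
        dip-at z here ¬α ¬β =
          +-≡-positive⇒< (trans (balance z) (cong₂ (λ a b → c z + (a + b)) (⟦⟧≡0 (α ≟ _) ¬α) (⟦⟧≡0 (β ≟ _) ¬β)))
            (positive here)
          where
          positive : α ≡ z ⊎ β ≡ z → 1 ≤ ⟦ α ≟ z ⟧ + ⟦ β ≟ z ⟧
          positive (inj₁ eq) = ≤-trans (≤-reflexive (sym (⟦⟧≡1 (α ≟ z) eq))) (m≤m+n _ _)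
          positive (inj₂ eq) = ≤-trans (≤-reflexive (sym (⟦⟧≡1 (β ≟ z) eq))) (m≤n+m _ _)

        peak-at : ∀ z → α ≡ z ⊕ 𝟙 ⊎ β ≡ z ⊝ 𝟙 → α ≢ z → β ≢ z → c z < W z
        peak-at z moved ¬α ¬β =
          +-≡-positive⇒< (trans (sym (balance z)) (cong₂ (λ a b → W z + (a + b)) (⟦⟧≡0 (α ≟ _) ¬α) (⟦⟧≡0 (β ≟ _) ¬β)))
            (positive moved)
          where
          positive : α ≡ z ⊕ 𝟙 ⊎ β ≡ z ⊝ 𝟙 → 1 ≤ ⟦ α ≟ z ⊕ 𝟙 ⟧ + ⟦ β ≟ z ⊝ 𝟙 ⟧
          positive (inj₁ eq) = ≤-trans (≤-reflexive (sym (⟦⟧≡1 (α ≟ _) eq))) (m≤m+n _ _)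
          positive (inj₂ eq) = ≤-trans (≤-reflexive (sym (⟦⟧≡1 (β ≟ _) eq))) (m≤n+m _ _)

      isFirstShift-α : IsFirstShift c W α
      isFirstShift-α =
        dip-at α (inj₁ refl) (≢⊕𝟙 α) β≢α⊝𝟙 ,
        peak-at (α ⊝ 𝟙) (inj₁ (sym (⊝-⊕-cancel α 𝟙))) (≢⊝𝟙 α) β≢α⊝𝟙

      isSecondShift-β : IsSecondShift c W β
      isSecondShift-β =
        dip-at β (inj₂ refl) α≢β⊕𝟙 (≢⊝𝟙 β) ,
        peak-at (β ⊕ 𝟙) (inj₂ (sym (⊕-⊝-cancel β 𝟙))) α≢β⊕𝟙 (≢⊕𝟙 β)

      isFirstShift-unique : ∀ z → IsFirstShift c W z → z ≡ α
      isFirstShift-unique z (dip , peak) with dip⇒shift z dip | peak⇒moved (z ⊝ 𝟙) peak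
      ... | inj₁ α≡z | _ = sym α≡z
      ... | inj₂ _ | inj₁ α≡z = sym (trans α≡z (⊝-⊕-cancel z 𝟙))
      ... | inj₂ β≡z | inj₂ β≡z⊝𝟙⊝𝟙 = ⊥-elim (≢⊝𝟙⊝𝟙 z (trans (sym β≡z) β≡z⊝𝟙⊝𝟙))

      isSecondShift-unique : ∀ z → IsSecondShift c W z → z ≡ β
      isSecondShift-unique z (dip , peak) with dip⇒shift z dip | peak⇒moved (z ⊕ 𝟙) peak
      ... | inj₂ β≡z | _ = sym β≡z
      ... | inj₁ _ | inj₂ β≡z = sym (trans β≡z (⊕-⊝-cancel z 𝟙))
      ... | inj₁ α≡z | inj₁ α≡z⊕𝟙⊕𝟙 = ⊥-elim (≢⊕𝟙⊕𝟙 z (trans (sym α≡z) α≡z⊕𝟙⊕𝟙))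

      firstShift≡α : firstShift c W ≡ α
      firstShift≡α = find-unique (isFirstShift? c W) isFirstShift-α isFirstShift-unique

      secondShift≡β : secondShift c W ≡ β
      secondShift≡β = find-unique (isSecondShift? c W) isSecondShift-β isSecondShift-unique

    module Bootstrap (y : Code) (y-perm : IsPerm y) where
      open Shifts y

      α β : Fin N
      α = shift zero
      β = shift (suc zero)

      β≢α⊝𝟙 : β ≢ α ⊝ 𝟙
      β≢α⊝𝟙 eq = 0≢1+n (cong toℕ (y-perm zero (suc zero) (trans y₀≡α (sym y₁≡α))))
        where
        y₀≡α : lookup y zero ≡ α
        y₀≡α = trans (sym (⊕-shift zero)) (⊕-identityˡ α)
        y₁≡α : lookup y (suc zero) ≡ α
        y₁≡α = trans (sym (⊕-shift (suc zero)))
                 (trans (cong (_⊕ β) suc-zero≡𝟙) (trans (cong (𝟙 ⊕_) eq) (⊕-⊝-cancelˡ 𝟙 α)))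

      rest : Fin N → ℕ
      rest z = sum (λ j → ⟦ shift (suc (suc j)) ≟ z ⟧)

      run-askProbe-1 : ∀ z → run y (askProbe z 1 𝟘) ≡ ⟦ α ≟ z ⊕ 𝟙 ⟧ + (⟦ β ≟ z ⊝ 𝟙 ⟧ + rest z)
      run-askProbe-1 z = trans (run-askProbe y z 1 𝟘) (cong₂ _+_ at-0 (cong₂ _+_ at-1 (sum-cong-≗ beyond)))
        where
        at-0 : ⟦ z ⊕ cycle 1 zero ≟ lookup y (𝟘 ⊕ zero) ⟧ ≡ ⟦ α ≟ z ⊕ 𝟙 ⟧
        at-0 rewrite ⊕-identityˡ zero | cycle-< 1 zero (s≤s z≤n) =
          ⟦hit⟧≡⟦shift⟧ zero (z ⊕ 𝟙) _ (trans (cong (z ⊕_) (⊕-identityˡ 𝟙)) (sym (⊕-identityʳ (z ⊕ 𝟙))))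
        at-1 : ⟦ z ⊕ cycle 1 (suc zero) ≟ lookup y (𝟘 ⊕ suc zero) ⟧ ≡ ⟦ β ≟ z ⊝ 𝟙 ⟧
        at-1 rewrite ⊕-identityˡ (suc zero) | cycle-≡ 1 (suc zero) refl =
          ⟦hit⟧≡⟦shift⟧ (suc zero) (z ⊝ 𝟙) _
            (trans (⊕-identityʳ z) (trans (sym (⊝-⊕-cancel z 𝟙)) (cong (z ⊝ 𝟙 ⊕_) (sym suc-zero≡𝟙))))
        beyond : ∀ j → ⟦ z ⊕ cycle 1 (suc (suc j)) ≟ lookup y (𝟘 ⊕ suc (suc j)) ⟧ ≡ ⟦ shift (suc (suc j)) ≟ z ⟧
        beyond j rewrite ⊕-identityˡ (suc (suc j)) | cycle-> 1 (suc (suc j)) (s≤s (s≤s z≤n)) =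
          ⟦hit⟧≡⟦shift⟧ (suc (suc j)) z _ refl

      balance : ∀ z → run y (askProbe z 1 𝟘) + (⟦ α ≟ z ⟧ + ⟦ β ≟ z ⟧) ≡ classSize z + (⟦ α ≟ z ⊕ 𝟙 ⟧ + ⟦ β ≟ z ⊝ 𝟙 ⟧)
      balance z = trans (cong (_+ (⟦ α ≟ z ⟧ + ⟦ β ≟ z ⟧)) (run-askProbe-1 z))
                    (rearrange ⟦ α ≟ z ⊕ 𝟙 ⟧ ⟦ β ≟ z ⊝ 𝟙 ⟧ (rest z) ⟦ α ≟ z ⟧ ⟦ β ≟ z ⟧)
        where
        rearrange : ∀ a b r a′ b′ → a + (b + r) + (a′ + b′) ≡ a′ + (b′ + r) + (a + b)
        rearrange = solve-∀

    L : ℕ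
    L = ⌈log₂ N ⌉

    -- kn i ≡ just c records that position i is known to have shift c.
    Knowledge : Set
    Knowledge = Fin N → Maybe (Fin N)

    _⊑_ : Knowledge → Knowledge → Set
    kn ⊑ kn′ = ∀ i c → kn i ≡ just c → kn′ i ≡ just c

    learn : Knowledge → Fin N → Fin N → Knowledge
    learn kn p c i with i ≟ p
    ... | yes _ = just c
    ... | no _ = kn i

    fillWith : Fin N → Knowledge → Knowledge
    fillWith c kn i = just (fromMaybe c (kn i))

    decode : Knowledge → Fin N → Fin N
    decode kn i = i ⊕ fromMaybe 𝟘 (kn i)

    isKnownAs : Fin N → Maybe (Fin N) → ℕ
    isKnownAs c (just c′) = ⟦ c′ ≟ c ⟧
    isKnownAs c nothing = 0

    isUnknown : Maybe (Fin N) → ℕ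
    isUnknown (just _) = 0
    isUnknown nothing = 1

    isUnknownIn : Fin N → Maybe (Fin N) → Fin N → ℕ
    isUnknownIn k nothing c = ⟦ c ≟ k ⟧
    isUnknownIn k (just _) c = 0

    isUnknownIn≤isUnknown : ∀ k mc c → isUnknownIn k mc c ≤ isUnknown mc
    isUnknownIn≤isUnknown k nothing c = ⟦⟧≤1 (c ≟ k)
    isUnknownIn≤isUnknown k (just _) c = z≤n

    isUnknownIn-positive : ∀ k mc c → 1 ≤ isUnknownIn k mc c → mc ≡ nothing × c ≡ k
    isUnknownIn-positive k nothing c pos = refl , ⟦⟧-positive (c ≟ k) pos

    knownIn : Knowledge → Fin N → ℕ
    knownIn kn c = sum (λ i → isKnownAs c (kn i))

    unknowns : Knowledge → ℕ
    unknowns kn = sum (λ i → isUnknown (kn i))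

    learn-here : ∀ kn p c → learn kn p c p ≡ just c
    learn-here kn p c with p ≟ p
    ... | yes _ = refl
    ... | no p≢p = ⊥-elim (p≢p refl)

    learn-there : ∀ kn p c i → i ≢ p → learn kn p c i ≡ kn i
    learn-there kn p c i i≢p with i ≟ p
    ... | yes i≡p = ⊥-elim (i≢p i≡p)
    ... | no _ = refl

    learn-extends : ∀ kn p c → kn p ≡ nothing → kn ⊑ learn kn p c
    learn-extends kn p c unknown i c′ known with i ≟ p
    ... | yes refl = ⊥-elim (nothing≢just (trans (sym unknown) known))
      where
      nothing≢just : nothing ≢ just c′
      nothing≢just ()
    ... | no _ = known

    knownIn-learn : ∀ kn p c → kn p ≡ nothing → knownIn (learn kn p c) c ≡ suc (knownIn kn c)
    knownIn-learn kn p c unknown = +-cancelʳ-≡ 0 _ _ (begin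
      knownIn (learn kn p c) c + 0                           ≡⟨ cong (λ t → knownIn (learn kn p c) c + isKnownAs c t) unknown ⟨
      knownIn (learn kn p c) c + isKnownAs c (kn p)          ≡⟨ sum-swap-at _ _ p (λ i i≢p → cong (isKnownAs c) (learn-there kn p c i i≢p)) ⟩
      knownIn kn c + isKnownAs c (learn kn p c p)            ≡⟨ cong (λ t → knownIn kn c + isKnownAs c t) (learn-here kn p c) ⟩
      knownIn kn c + ⟦ c ≟ c ⟧                               ≡⟨ cong (knownIn kn c +_) (⟦⟧≡1 (c ≟ c) refl) ⟩
      knownIn kn c + 1                                       ≡⟨ +-comm (knownIn kn c) 1 ⟩
      suc (knownIn kn c)                                     ≡⟨ +-identityʳ _ ⟨
      suc (knownIn kn c) + 0                                 ∎)
      where open ≡-Reasoning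

    unknowns-learn : ∀ kn p c → kn p ≡ nothing → unknowns (learn kn p c) + 1 ≡ unknowns kn
    unknowns-learn kn p c unknown = begin
      unknowns (learn kn p c) + 1                       ≡⟨ cong (λ t → unknowns (learn kn p c) + isUnknown t) unknown ⟨
      unknowns (learn kn p c) + isUnknown (kn p)        ≡⟨ sum-swap-at _ _ p (λ i i≢p → cong isUnknown (learn-there kn p c i i≢p)) ⟩
      unknowns kn + isUnknown (learn kn p c p)          ≡⟨ cong (λ t → unknowns kn + isUnknown t) (learn-here kn p c) ⟩
      unknowns kn + 0                                   ≡⟨ +-identityʳ _ ⟩
      unknowns kn                                       ∎
      where open ≡-Reasoning

    unknowns-fillWith : ∀ c kn → unknowns (fillWith c kn) ≡ 0
    unknowns-fillWith c kn = sum-zero (λ i → isUnknown (fillWith c kn i)) (λ _ → refl)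

    -- With v = y 0, askProbe v m (anchor v k) tests position anchor v k ⊕ j for shift k when j < m,
    -- for being position 0 when j = m, and for shift k ⊝ 𝟙 when j > m.
    anchor : Fin N → Fin N → Fin N
    anchor v k = v ⊕ 𝟙 ⊝ k

    knownHit : Fin N → Fin N → Knowledge → ℕ → Fin N → ℕ
    knownHit v k kn m j with <-cmp (toℕ j) m
    ... | tri< _ _ _ = isKnownAs k (kn (anchor v k ⊕ j))
    ... | tri≈ _ _ _ = ⟦ anchor v k ⊕ j ≟ 𝟘 ⟧
    ... | tri> _ _ _ = isKnownAs (k ⊝ 𝟙) (kn (anchor v k ⊕ j))

    knownHits : Fin N → Fin N → Knowledge → ℕ → ℕ
    knownHits v k kn m = sum (knownHit v k kn m)

    testPrefix : Fin N → Fin N → Knowledge → ℕ → Protocol Bool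
    testPrefix v k kn m = askProbe v m (anchor v k) >>= λ r → done (does (knownHits v k kn m <? r))

    locate : Fin N → Fin N → Knowledge → Protocol Knowledge
    locate v k kn = binarySearch N 0 N (testPrefix v k kn) >>= λ x → done (learn kn (anchor v k ⊕ (x mod N)) k)

    locateAll : Fin N → Fin N → ℕ → Knowledge → Protocol Knowledge
    locateAll v k zero kn = done kn
    locateAll v k (suc r) kn = locate v k kn >>= locateAll v k r

    cost-locate : ∀ y v k kn → cost y (locate v k kn) ≤ L
    cost-locate y v k kn = begin
      cost y (locate v k kn)
        ≡⟨ cost->>= y (binarySearch N 0 N (testPrefix v k kn)) (λ x → done (learn kn (anchor v k ⊕ (x mod N)) k)) ⟩
      cost y (binarySearch N 0 N (testPrefix v k kn)) + 0
        ≡⟨ +-identityʳ _ ⟩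
      cost y (binarySearch N 0 N (testPrefix v k kn))
        ≤⟨ binarySearch-cost {y} {testPrefix v k kn} (λ _ → ≤-refl) N 0 N ⟩
      L
        ∎
      where open ≤-Reasoning

    cost-locateAll : ∀ y v k r kn → cost y (locateAll v k r kn) ≤ r * L
    cost-locateAll y v k zero kn = z≤n
    cost-locateAll y v k (suc r) kn = begin
      cost y (locateAll v k (suc r) kn)                                        ≡⟨ cost->>= y (locate v k kn) (locateAll v k r) ⟩
      cost y (locate v k kn) + cost y (locateAll v k r (run y (locate v k kn))) ≤⟨ +-mono-≤ (cost-locate y v k kn) (cost-locateAll y v k r _) ⟩
      L + r * L                                                                ∎
      where open ≤-Reasoning

    completeClass : (Fin N → ℕ) → Fin N → Fin N → Knowledge → Protocol Knowledge
    completeClass c v k kn with c k ∸ knownIn kn k ℕ.≟ unknowns kn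
    ... | yes _ = done (fillWith k kn)
    ... | no _ = locateAll v k (c k ∸ knownIn kn k) kn

    completeClasses : (Fin N → ℕ) → Fin N → ℕ → Fin N → Knowledge → Protocol Knowledge
    completeClasses c v zero k kn = done kn
    completeClasses c v (suc t) k kn = completeClass c v k kn >>= completeClasses c v t (k ⊕ 𝟙)

    module ClassAnalysis (y : Code) (y-perm : IsPerm y) where
      open Shifts y

      Sound : Knowledge → Set
      Sound kn = ∀ i c → kn i ≡ just c → shift i ≡ c

      Complete : Fin N → Knowledge → Set
      Complete c kn = ∀ i → shift i ≡ c → kn i ≡ just c

      complete-⊑ : ∀ {c kn kn′} → kn ⊑ kn′ → Complete c kn → Complete c kn′
      complete-⊑ ext complete i eq = ext i _ (complete i eq)

      Covered : ℕ → Fin N → Knowledge → Set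
      Covered t k kn = ∀ c → Complete c kn ⊎ toℕ (c ⊝ k) < t

      covered-zero : ∀ {k kn} → Covered 0 k kn → ∀ c → Complete c kn
      covered-zero covered c with covered c
      ... | inj₁ complete = complete

      covered-suc : ∀ {t k kn kn′} → kn ⊑ kn′ → Complete k kn′ → Covered (suc t) k kn → Covered t (k ⊕ 𝟙) kn′
      covered-suc {t} {k} extends complete-k covered c with covered c
      ... | inj₁ complete-c = inj₁ (complete-⊑ extends complete-c)
      ... | inj₂ lt with c ≟ k
      ...   | yes refl = inj₁ complete-k
      ...   | no c≢k = inj₂ (s≤s⁻¹ (subst (_≤ suc t) (sym (cong suc (toℕ-⊝-⊕𝟙 c k c≢k))) lt))

      unknownIn : Knowledge → Fin N → ℕ
      unknownIn kn k = sum (λ i → isUnknownIn k (kn i) (shift i))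

      learn-sound : ∀ {kn p k} → Sound kn → shift p ≡ k → Sound (learn kn p k)
      learn-sound {kn} {p} {k} sound shift-p i c known with i ≟ p
      ... | yes refl = trans shift-p (just-injective known)
      ... | no _ = sound i c known

      unknownIn≤unknowns : ∀ kn k → unknownIn kn k ≤ unknowns kn
      unknownIn≤unknowns kn k = sum-mono-≤ (λ i → isUnknownIn≤isUnknown k (kn i) (shift i))

      module _ {kn : Knowledge} (sound : Sound kn) where

        ⟦shift⟧-split : ∀ k i → ⟦ shift i ≟ k ⟧ ≡ isUnknownIn k (kn i) (shift i) + isKnownAs k (kn i)
        ⟦shift⟧-split k i with kn i in eq
        ... | nothing = sym (+-identityʳ _)
        ... | just c rewrite sound i c eq = refl

        ⟦shift⟧-complete : ∀ {k} → Complete k kn → ∀ i → ⟦ shift i ≟ k ⟧ ≡ isKnownAs k (kn i)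
        ⟦shift⟧-complete {k} complete i with shift i ≟ k
        ... | yes eq rewrite complete i eq = sym (⟦⟧≡1 (k ≟ k) refl)
        ... | no neq with kn i in eq
        ...   | nothing = refl
        ...   | just c = sym (⟦⟧≡0 (c ≟ k) (λ c≡k → neq (trans (sound i c eq) c≡k)))

        classSize-split : ∀ k → classSize k ≡ unknownIn kn k + knownIn kn k
        classSize-split k =
          trans (sum-cong-≗ (⟦shift⟧-split k)) (∑-distrib-+ (λ i → isUnknownIn k (kn i) (shift i)) (λ i → isKnownAs k (kn i)))

        isKnownAs≤⟦shift⟧ : ∀ k i → isKnownAs k (kn i) ≤ ⟦ shift i ≟ k ⟧
        isKnownAs≤⟦shift⟧ k i = ≤-trans (m≤n+m _ _) (≤-reflexive (sym (⟦shift⟧-split k i)))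

        complete-by-count : ∀ k → classSize k ≤ knownIn kn k → Complete k kn
        complete-by-count k ≤known i eq
          with sum-≤-pointwise-≡ (λ i → ⟦ shift i ≟ k ⟧) (λ i → isKnownAs k (kn i)) (isKnownAs≤⟦shift⟧ k) ≤known i
        ... | same with kn i
        ...   | nothing = ⊥-elim (1+n≢0′ (trans (sym (⟦⟧≡1 (shift i ≟ k) eq)) same))
          where
          1+n≢0′ : 1 ≢ 0
          1+n≢0′ ()
        ...   | just c = cong just (⟦⟧-positive (c ≟ k) (≤-reflexive (trans (sym (⟦⟧≡1 (shift i ≟ k) eq)) same)))

      module Completion (v : Fin N) (y₀≡v : lookup y 𝟘 ≡ v) where

        module Locate (k : Fin N) {kn : Knowledge} (sound : Sound kn) (previous : Complete (k ⊝ 𝟙) kn) where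

          a : Fin N
          a = anchor v k

          hits-class : ∀ j → v ⊕ (j ⊕ 𝟙) ≡ k ⊕ (a ⊕ j)
          hits-class j = begin
            v ⊕ (j ⊕ 𝟙)      ≡⟨ cong (v ⊕_) (⊕-comm j 𝟙) ⟩
            v ⊕ (𝟙 ⊕ j)      ≡⟨ ⊕-assoc v 𝟙 j ⟨
            v ⊕ 𝟙 ⊕ j        ≡⟨ cong (_⊕ j) (⊕-⊝-cancelˡ k (v ⊕ 𝟙)) ⟨
            k ⊕ a ⊕ j        ≡⟨ ⊕-assoc k a j ⟩
            k ⊕ (a ⊕ j)      ∎
            where open ≡-Reasoning

          hits-previous-class : ∀ j → v ⊕ j ≡ (k ⊝ 𝟙) ⊕ (a ⊕ j)
          hits-previous-class j = begin
            v ⊕ j                ≡⟨ cong (_⊕ j) (⊕-⊝-cancel v 𝟙) ⟨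
            v ⊕ 𝟙 ⊝ 𝟙 ⊕ j        ≡⟨ cong (λ t → t ⊝ 𝟙 ⊕ j) (⊕-⊝-cancelˡ k (v ⊕ 𝟙)) ⟨
            k ⊕ a ⊝ 𝟙 ⊕ j        ≡⟨ cong (_⊕ j) (⊝-⊕-comm k 𝟙 a) ⟨
            k ⊝ 𝟙 ⊕ a ⊕ j        ≡⟨ ⊕-assoc (k ⊝ 𝟙) a j ⟩
            (k ⊝ 𝟙) ⊕ (a ⊕ j)    ∎
            where open ≡-Reasoning

          unknownAt : Fin N → ℕ
          unknownAt j = isUnknownIn k (kn (a ⊕ j)) (shift (a ⊕ j))

          unknownPrefix : ℕ → ℕ
          unknownPrefix m = sum (λ j → whenBelow (toℕ j) m (unknownAt j))

          hit-split : ∀ m j → ⟦ v ⊕ cycle m j ≟ lookup y (a ⊕ j) ⟧ ≡ whenBelow (toℕ j) m (unknownAt j) + knownHit v k kn m j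
          hit-split m j with <-cmp (toℕ j) m
          ... | tri< j<m _ _ = begin
            ⟦ v ⊕ (j ⊕ 𝟙) ≟ lookup y (a ⊕ j) ⟧                          ≡⟨ ⟦hit⟧≡⟦shift⟧ (a ⊕ j) k _ (hits-class j) ⟩
            ⟦ shift (a ⊕ j) ≟ k ⟧                                       ≡⟨ ⟦shift⟧-split sound k (a ⊕ j) ⟩
            unknownAt j + isKnownAs k (kn (a ⊕ j))                      ≡⟨ cong (_+ _) (whenBelow-< (unknownAt j) j<m) ⟨
            whenBelow (toℕ j) m (unknownAt j) + isKnownAs k (kn (a ⊕ j)) ∎
            where open ≡-Reasoning
          ... | tri≈ j≮m _ _ = trans (⟦⟧-cong (v ⊕ 𝟘 ≟ lookup y (a ⊕ j)) (a ⊕ j ≟ 𝟘) hit⇒𝟘 𝟘⇒hit)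
                                     (cong (_+ _) (sym (whenBelow-≮ (unknownAt j) j≮m)))
            where
            hit⇒𝟘 : v ⊕ 𝟘 ≡ lookup y (a ⊕ j) → a ⊕ j ≡ 𝟘
            hit⇒𝟘 hit = y-perm _ _ (trans (sym hit) (trans (⊕-identityʳ v) (sym y₀≡v)))
            𝟘⇒hit : a ⊕ j ≡ 𝟘 → v ⊕ 𝟘 ≡ lookup y (a ⊕ j)
            𝟘⇒hit eq = trans (⊕-identityʳ v) (trans (sym y₀≡v) (cong (lookup y) (sym eq)))
          ... | tri> j≮m _ _ = begin
            ⟦ v ⊕ j ≟ lookup y (a ⊕ j) ⟧                                      ≡⟨ ⟦hit⟧≡⟦shift⟧ (a ⊕ j) (k ⊝ 𝟙) _ (hits-previous-class j) ⟩
            ⟦ shift (a ⊕ j) ≟ k ⊝ 𝟙 ⟧                                         ≡⟨ ⟦shift⟧-complete sound previous (a ⊕ j) ⟩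
            isKnownAs (k ⊝ 𝟙) (kn (a ⊕ j))                                    ≡⟨ cong (_+ _) (whenBelow-≮ (unknownAt j) j≮m) ⟨
            whenBelow (toℕ j) m (unknownAt j) + isKnownAs (k ⊝ 𝟙) (kn (a ⊕ j)) ∎
            where open ≡-Reasoning

          run-askProbe-anchor : ∀ m → run y (askProbe v m a) ≡ unknownPrefix m + knownHits v k kn m
          run-askProbe-anchor m =
            trans (run-askProbe y v m a)
              (trans (sum-cong-≗ (hit-split m))
                (∑-distrib-+ (λ j → whenBelow (toℕ j) m (unknownAt j)) (knownHit v k kn m)))

          hasUnknown : ℕ → Bool
          hasUnknown m = positive? (unknownPrefix m) (knownHits v k kn m)

          realises : Realises y (testPrefix v k kn) hasUnknown
          realises m = trans (run->>= y (askProbe v m a) (λ r → done (does (knownHits v k kn m <? r))))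
                             (cong (λ r → does (knownHits v k kn m <? r)) (run-askProbe-anchor m))

          unknownPrefix-zero : unknownPrefix 0 ≡ 0
          unknownPrefix-zero = sum-zero (λ j → whenBelow (toℕ j) 0 (unknownAt j)) (λ j → whenBelow-≮ {toℕ j} {0} (unknownAt j) (λ ()))

          unknownPrefix-N : unknownPrefix N ≡ unknownIn kn k
          unknownPrefix-N = trans (sum-cong-≗ (λ j → whenBelow-< (unknownAt j) (toℕ<n j)))
                                  (sym (sum-translate (λ i → isUnknownIn k (kn i) (shift i)) a))

          unknownPrefix-suc : ∀ x → (j : Fin N) → toℕ j ≡ x → unknownPrefix (suc x) ≡ unknownPrefix x + unknownAt j
          unknownPrefix-suc x j j≡x = +-cancelʳ-≡ 0 _ _ (begin
            unknownPrefix (suc x) + 0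
              ≡⟨ cong (unknownPrefix (suc x) +_) (whenBelow-≮ (unknownAt j) (λ lt → <-irrefl j≡x lt)) ⟨
            unknownPrefix (suc x) + whenBelow (toℕ j) x (unknownAt j)
              ≡⟨ sum-swap-at _ _ j (λ i i≢j → whenBelow-suc (unknownAt i) (λ eq → i≢j (toℕ-injective (trans eq (sym j≡x))))) ⟩
            unknownPrefix x + whenBelow (toℕ j) (suc x) (unknownAt j)
              ≡⟨ cong (unknownPrefix x +_) (whenBelow-< (unknownAt j) (subst (_< suc x) (sym j≡x) (n<1+n x))) ⟩
            unknownPrefix x + unknownAt j
              ≡⟨ +-identityʳ _ ⟨
            unknownPrefix x + unknownAt j + 0
              ∎)
            where open ≡-Reasoning

          step-is-unknown : ∀ x → StepIn hasUnknown 0 N x → 1 ≤ unknownAt (x mod N)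
          step-is-unknown x (_ , x<N , before , after) =
            subst (1 ≤_) (trans (unknownPrefix-suc x (x mod N) toℕ-x-mod-N)
                                (cong (_+ unknownAt (x mod N)) (positive?-false⇒ (unknownPrefix x) (knownHits v k kn x) before)))
                  (positive?-true⇒ (unknownPrefix (suc x)) (knownHits v k kn (suc x)) after)
            where
            toℕ-x-mod-N : toℕ (x mod N) ≡ x
            toℕ-x-mod-N = trans (toℕ-fromℕ< (m%n<n x N)) (m<n⇒m%n≡m x<N)

          room⇒unknownIn : knownIn kn k < classSize k → 1 ≤ unknownIn kn k
          room⇒unknownIn room = +-≡-<⇒positive split room
            where
            split : knownIn kn k + unknownIn kn k ≡ classSize k + 0
            split = trans (+-comm (knownIn kn k) _) (trans (sym (classSize-split sound k)) (sym (+-identityʳ _)))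

          opaque
            searchResult : ℕ
            searchResult = run y (binarySearch N 0 N (testPrefix v k kn))

            searchResult-step : knownIn kn k < classSize k → StepIn hasUnknown 0 N searchResult
            searchResult-step room = binarySearch-finds-step {y} {testPrefix v k kn} {hasUnknown} realises N 0 N
              (trans (cong (λ u → positive? u (knownHits v k kn 0)) unknownPrefix-zero) (positive?-zero (knownHits v k kn 0)))
              (positive?-≥1 (unknownPrefix N) (knownHits v k kn N) (subst (1 ≤_) (sym unknownPrefix-N) (room⇒unknownIn room)))
              (s≤s z≤n) (n≤1+n N)

            run-locate : run y (locate v k kn) ≡ learn kn (a ⊕ (searchResult mod N)) k
            run-locate = run->>= y (binarySearch N 0 N (testPrefix v k kn)) (λ x → done (learn kn (a ⊕ (x mod N)) k))

          locate-finds : knownIn kn k < classSize k →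
            ∃ λ p → kn p ≡ nothing × shift p ≡ k × run y (locate v k kn) ≡ learn kn p k
          locate-finds room =
            let (unknown , in-class) = isUnknownIn-positive k (kn (a ⊕ (searchResult mod N))) (shift (a ⊕ (searchResult mod N)))
                                         (step-is-unknown searchResult (searchResult-step room))
            in _ , unknown , in-class , run-locate

        record LocatedAll (k : Fin N) (r : ℕ) (kn kn′ : Knowledge) : Set where
          field
            sound′    : Sound kn′
            extends   : kn ⊑ kn′
            known′    : knownIn kn′ k ≡ knownIn kn k + r
            unknowns′ : unknowns kn′ + r ≡ unknowns kn

        locateAll-correct : ∀ k r {kn} → Sound kn → Complete (k ⊝ 𝟙) kn → knownIn kn k + r ≡ classSize k →
          LocatedAll k r kn (run y (locateAll v k r kn))
        locateAll-correct k zero sound _ _ =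
          record { sound′ = sound ; extends = λ _ _ known → known ; known′ = sym (+-identityʳ _) ; unknowns′ = +-identityʳ _ }
        locateAll-correct k (suc r) {kn} sound previous total = continue (Locate.locate-finds k sound previous room)
          where
          room : knownIn kn k < classSize k
          room = ≤-trans (s≤s (m≤m+n (knownIn kn k) r)) (≤-reflexive (trans (sym (+-suc _ r)) total))
          continue : ∃ (λ p → kn p ≡ nothing × shift p ≡ k × run y (locate v k kn) ≡ learn kn p k) →
                     LocatedAll k (suc r) kn (run y (locateAll v k (suc r) kn))
          continue (p , unknown , in-class , run-locate) =
            subst (LocatedAll k (suc r) kn) (sym resumes) (record
              { sound′ = sound′
              ; extends = λ i c known → extends i c (learn-extends kn p k unknown i c known)
              ; known′ = trans known′ (trans (cong (_+ r) (knownIn-learn kn p k unknown)) (sym (+-suc _ r)))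
              ; unknowns′ = trans (+-suc _ r) (trans (cong suc unknowns′) (trans (+-comm 1 _) (unknowns-learn kn p k unknown))) })
            where
            resumes : run y (locateAll v k (suc r) kn) ≡ run y (locateAll v k r (learn kn p k))
            resumes = trans (run->>= y (locate v k kn) (locateAll v k r)) (cong (λ t → run y (locateAll v k r t)) run-locate)
            open LocatedAll (locateAll-correct k r (learn-sound sound in-class)
                              (complete-⊑ (learn-extends kn p k unknown) previous)
                              (trans (cong (_+ r) (knownIn-learn kn p k unknown)) (trans (sym (+-suc _ r)) total)))

        -- The potential (unknowns − 1) · L pays for one search per unknown position but one:
        -- the last class is filled without search.
        record CompletesClass (k : Fin N) (kn : Knowledge) (p : Protocol Knowledge) : Set where
          field
            sound′    : Sound (run y p)
            extends   : kn ⊑ run y p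
            complete  : Complete k (run y p)
            potential : cost y p + (unknowns (run y p) ∸ 1) * L ≤ (unknowns kn ∸ 1) * L

        record CompletesAll (kn : Knowledge) (p : Protocol Knowledge) : Set where
          field
            sound′    : Sound (run y p)
            complete  : ∀ c → Complete c (run y p)
            potential : cost y p + (unknowns (run y p) ∸ 1) * L ≤ (unknowns kn ∸ 1) * L

        module _ (c : Fin N → ℕ) (c≗classSize : ∀ k → c k ≡ classSize k) where

          module _ (k : Fin N) {kn : Knowledge} (sound : Sound kn) where

            c∸known≡unknownIn : c k ∸ knownIn kn k ≡ unknownIn kn k
            c∸known≡unknownIn = trans (cong (_∸ knownIn kn k) (trans (c≗classSize k) (classSize-split sound k)))
                                      (m+n∸n≡m (unknownIn kn k) (knownIn kn k))

            known+missing≡classSize : knownIn kn k + (c k ∸ knownIn kn k) ≡ classSize k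
            known+missing≡classSize = begin
              knownIn kn k + (c k ∸ knownIn kn k)  ≡⟨ cong (knownIn kn k +_) c∸known≡unknownIn ⟩
              knownIn kn k + unknownIn kn k        ≡⟨ +-comm (knownIn kn k) _ ⟩
              unknownIn kn k + knownIn kn k        ≡⟨ classSize-split sound k ⟨
              classSize k                          ∎
              where open ≡-Reasoning

            unknown⇒in-class : c k ∸ knownIn kn k ≡ unknowns kn → ∀ i → kn i ≡ nothing → shift i ≡ k
            unknown⇒in-class all-missing i unknown =
              ⟦⟧-positive (shift i ≟ k)
                (≤-reflexive (trans (cong isUnknown (sym unknown)) (trans (pointwise i) (cong (λ t → isUnknownIn k t (shift i)) unknown))))
              where
              pointwise : ∀ i → isUnknown (kn i) ≡ isUnknownIn k (kn i) (shift i)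
              pointwise = sum-≤-pointwise-≡ (λ i → isUnknown (kn i)) (λ i → isUnknownIn k (kn i) (shift i))
                            (λ i → isUnknownIn≤isUnknown k (kn i) (shift i))
                            (≤-reflexive (trans (sym all-missing) c∸known≡unknownIn))

            fillWith-completes : c k ∸ knownIn kn k ≡ unknowns kn → CompletesClass k kn (done (fillWith k kn))
            fillWith-completes all-missing = record
              { sound′ = sound′
              ; extends = λ i c′ known → cong (λ t → just (fromMaybe k t)) known
              ; complete = complete
              ; potential = ≤-trans (≤-reflexive (cong (λ u → (u ∸ 1) * L) (unknowns-fillWith k kn))) z≤n }
              where
              sound′ : Sound (fillWith k kn)
              sound′ i c′ filled with kn i in known
              ... | nothing = trans (unknown⇒in-class all-missing i known) (just-injective filled)
              ... | just c₀ = trans (sound i c₀ known) (just-injective filled)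
              complete : Complete k (fillWith k kn)
              complete i in-class with kn i in known
              ... | nothing = refl
              ... | just c₀ = cong just (trans (sym (sound i c₀ known)) in-class)

            locateAll-completes : c k ∸ knownIn kn k ≢ unknowns kn → Complete (k ⊝ 𝟙) kn →
              CompletesClass k kn (locateAll v k (c k ∸ knownIn kn k) kn)
            locateAll-completes some-missing previous = record
              { sound′ = sound′
              ; extends = extends
              ; complete = complete-by-count sound′ k (≤-reflexive (sym (trans known′ known+missing≡classSize)))
              ; potential = begin
                  cost y (locateAll v k r kn) + (unknowns kn′ ∸ 1) * L  ≤⟨ +-monoˡ-≤ _ (cost-locateAll y v k r kn) ⟩
                  r * L + (unknowns kn′ ∸ 1) * L                        ≡⟨ locateAll-potential r (unknowns kn) (unknowns kn′) L r<unknowns unknowns′ ⟩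
                  (unknowns kn ∸ 1) * L                                 ∎ }
              where
              open ≤-Reasoning
              r : ℕ
              r = c k ∸ knownIn kn k
              kn′ : Knowledge
              kn′ = run y (locateAll v k r kn)
              r<unknowns : r < unknowns kn
              r<unknowns = ≤∧≢⇒< (≤-trans (≤-reflexive c∸known≡unknownIn) (unknownIn≤unknowns kn k)) some-missing
              open LocatedAll (locateAll-correct k r sound previous known+missing≡classSize)

          completeClass-correct : ∀ k {kn} → Sound kn → Complete (k ⊝ 𝟙) kn → CompletesClass k kn (completeClass c v k kn)
          completeClass-correct k {kn} sound previous with c k ∸ knownIn kn k ℕ.≟ unknowns kn
          ... | yes all-missing = fillWith-completes k sound all-missing
          ... | no some-missing = locateAll-completes k sound some-missing previous

          completeClasses-correct : ∀ t k {kn} → Sound kn → Complete (k ⊝ 𝟙) kn → Covered t k kn →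
            CompletesAll kn (completeClasses c v t k kn)
          completeClasses-correct zero k sound _ covered = record
            { sound′ = sound ; complete = covered-zero covered ; potential = ≤-refl }
          completeClasses-correct (suc t) k {kn} sound previous covered = record
            { sound′ = subst Sound (sym resumes) sound′
            ; complete = λ c′ → subst (Complete c′) (sym resumes) (complete c′)
            ; potential = begin
                cost y (completeClasses c v (suc t) k kn) + (unknowns (run y (completeClasses c v (suc t) k kn)) ∸ 1) * L
                  ≡⟨ cong₂ _+_ (cost->>= y (completeClass c v k kn) (completeClasses c v t (k ⊕ 𝟙)))
                               (cong (λ kn′ → (unknowns kn′ ∸ 1) * L) resumes) ⟩
                cost y (completeClass c v k kn) + cost y rest + (unknowns (run y rest) ∸ 1) * L
                  ≡⟨ +-assoc (cost y (completeClass c v k kn)) _ _ ⟩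
                cost y (completeClass c v k kn) + (cost y rest + (unknowns (run y rest) ∸ 1) * L)
                  ≤⟨ +-monoʳ-≤ (cost y (completeClass c v k kn)) potential ⟩
                cost y (completeClass c v k kn) + (unknowns kn₁ ∸ 1) * L
                  ≤⟨ CompletesClass.potential first ⟩
                (unknowns kn ∸ 1) * L ∎ }
            where
            first : CompletesClass k kn (completeClass c v k kn)
            first = completeClass-correct k sound previous
            kn₁ : Knowledge
            kn₁ = run y (completeClass c v k kn)
            rest : Protocol Knowledge
            rest = completeClasses c v t (k ⊕ 𝟙) kn₁
            resumes : run y (completeClasses c v (suc t) k kn) ≡ run y rest
            resumes = run->>= y (completeClass c v k kn) (completeClasses c v t (k ⊕ 𝟙))
            open ≤-Reasoning
            open CompletesAll (completeClasses-correct t (k ⊕ 𝟙) (CompletesClass.sound′ first)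
                                (subst (λ k′ → Complete k′ kn₁) (sym (⊕-⊝-cancel k 𝟙)) (CompletesClass.complete first))
                                (covered-suc (CompletesClass.extends first) (CompletesClass.complete first) covered))

    initialKnowledge : Fin N → Fin N → Knowledge
    initialKnowledge α β zero = just α
    initialKnowledge α β (suc zero) = just β
    initialKnowledge α β (suc (suc _)) = nothing

    firstComplete : (Fin N → ℕ) → Knowledge → Fin N
    firstComplete c kn = find (λ z → c z ≤? knownIn kn z)

    askClassSizes : Protocol (Fin N → ℕ)
    askClassSizes = askAll (λ z → askProbe z 0 𝟘)

    askShiftedSizes : Protocol (Fin N → ℕ)
    askShiftedSizes = askAll (λ z → askProbe z 1 𝟘)

    knowledge₀ : (c W : Fin N → ℕ) → Knowledge
    knowledge₀ c W = initialKnowledge (firstShift c W) (secondShift c W)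

    completeAll : (c W : Fin N → ℕ) → Protocol Knowledge
    completeAll c W = completeClasses c (firstShift c W) (N ∸ 1) (firstComplete c (knowledge₀ c W) ⊕ 𝟙) (knowledge₀ c W)

    opaque
      decoder : Protocol (Fin N → Fin N)
      decoder = askClassSizes >>= λ c → askShiftedSizes >>= λ W → completeAll c W >>= λ kn → done (decode kn)

      decoder-stages : decoder ≡ (askClassSizes >>= λ c → askShiftedSizes >>= λ W → completeAll c W >>= λ kn → done (decode kn))
      decoder-stages = refl

    module Correctness (y : Code) (y-perm : IsPerm y) where
      open Shifts y
      open Bootstrap y y-perm
      open ClassAnalysis y y-perm

      run-askClassSizes : ∀ k → run y askClassSizes k ≡ classSize k
      run-askClassSizes k = trans (run-askAll y (λ z → askProbe z 0 𝟘) k) (run-askProbe-0 k)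

      run-askShiftedSizes : ∀ z →
        run y askShiftedSizes z + (⟦ α ≟ z ⟧ + ⟦ β ≟ z ⟧) ≡ classSize z + (⟦ α ≟ z ⊕ 𝟙 ⟧ + ⟦ β ≟ z ⊝ 𝟙 ⟧)
      run-askShiftedSizes z = trans (cong (_+ (⟦ α ≟ z ⟧ + ⟦ β ≟ z ⟧)) (run-askAll y (λ z → askProbe z 1 𝟘) z)) (balance z)

      module Answers (c W : Fin N → ℕ) (c≗classSize : ∀ k → c k ≡ classSize k)
        (W-balance : ∀ z → W z + (⟦ α ≟ z ⟧ + ⟦ β ≟ z ⟧) ≡ classSize z + (⟦ α ≟ z ⊕ 𝟙 ⟧ + ⟦ β ≟ z ⊝ 𝟙 ⟧)) where

        balance′ : ∀ z → W z + (⟦ α ≟ z ⟧ + ⟦ β ≟ z ⟧) ≡ c z + (⟦ α ≟ z ⊕ 𝟙 ⟧ + ⟦ β ≟ z ⊝ 𝟙 ⟧)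
        balance′ z = trans (W-balance z) (cong (_+ (⟦ α ≟ z ⊕ 𝟙 ⟧ + ⟦ β ≟ z ⊝ 𝟙 ⟧)) (sym (c≗classSize z)))

        open Balance c W α β β≢α⊝𝟙 balance′ using (firstShift≡α; secondShift≡β)

        kn₀ : Knowledge
        kn₀ = knowledge₀ c W

        sound₀ : Sound kn₀
        sound₀ zero _ known = trans (sym firstShift≡α) (just-injective known)
        sound₀ (suc zero) _ known = trans (sym secondShift≡β) (just-injective known)

        y₀≡firstShift : lookup y 𝟘 ≡ firstShift c W
        y₀≡firstShift = trans (sym (⊕-shift zero)) (trans (⊕-identityˡ α) (sym firstShift≡α))

        sum-knownIn₀ : sum (knownIn kn₀) ≡ 2
        sum-knownIn₀ = begin
          sum (λ z → sum (λ i → isKnownAs z (kn₀ i)))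
            ≡⟨ ∑-comm (λ z i → isKnownAs z (kn₀ i)) ⟩
          sum (λ i → sum (λ z → isKnownAs z (kn₀ i)))
            ≡⟨ cong₂ (λ a b → a + (b + sum {suc m} (λ j → sum {N} (λ _ → 0)))) (sum-⟦≟⟧ (firstShift c W)) (sum-⟦≟⟧ (secondShift c W)) ⟩
          1 + (1 + sum {suc m} (λ j → sum {N} (λ _ → 0)))
            ≡⟨ cong (λ t → 1 + (1 + t)) (sum-zero {suc m} (λ j → sum {N} (λ _ → 0)) (λ j → sum-zero {N} (λ _ → 0) (λ _ → refl))) ⟩
          2
            ∎
          where open ≡-Reasoning

        z₀ : Fin N
        z₀ = firstComplete c kn₀

        z₀-complete : Complete z₀ kn₀
        z₀-complete = complete-by-count sound₀ z₀
          (subst (_≤ knownIn kn₀ z₀) (c≗classSize z₀) (find-satisfies (λ z → c z ≤? knownIn kn₀ z) some-class-complete))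
          where
          open ≤-Reasoning
          some-class-complete : ¬ (∀ z → ¬ c z ≤ knownIn kn₀ z)
          some-class-complete none = <-irrefl refl (begin-strict
            N                                      <⟨ m<m+n N (s≤s z≤n) ⟩
            N + 2                                  ≡⟨ cong₂ _+_ (sum-ones N) sum-knownIn₀ ⟨
            sum {N} (λ _ → 1) + sum (knownIn kn₀)  ≡⟨ ∑-distrib-+ (λ _ → 1) (knownIn kn₀) ⟨
            sum (λ z → suc (knownIn kn₀ z))        ≤⟨ sum-mono-≤ (λ z → ≰⇒> (none z)) ⟩
            sum c                                  ≡⟨ sum-cong-≗ c≗classSize ⟩
            sum classSize                          ≡⟨ sum-classSize ⟩
            N                                      ∎)

        covered₀ : Covered (N ∸ 1) (z₀ ⊕ 𝟙) kn₀
        covered₀ c′ with c′ ≟ z₀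
        ... | yes refl = inj₁ z₀-complete
        ... | no c′≢z₀ = inj₂ (s≤s⁻¹ (subst (_< N) (sym (toℕ-⊝-⊕𝟙 c′ z₀ c′≢z₀)) (toℕ<n (c′ ⊝ z₀))))

        open Completion (firstShift c W) y₀≡firstShift

        completeAll-correct : CompletesAll kn₀ (completeAll c W)
        completeAll-correct = completeClasses-correct c c≗classSize (N ∸ 1) (z₀ ⊕ 𝟙) sound₀
          (subst (λ k → Complete k kn₀) (sym (⊕-⊝-cancel z₀ 𝟙)) z₀-complete) covered₀

        completeAll-complete : ∀ k → Complete k (run y (completeAll c W))
        completeAll-complete = CompletesAll.complete completeAll-correct

        completeAll-cost : cost y (completeAll c W) ≤ m * L
        completeAll-cost = begin
          cost y (completeAll c W)                                                 ≤⟨ m≤m+n _ _ ⟩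
          cost y (completeAll c W) + (unknowns (run y (completeAll c W)) ∸ 1) * L  ≤⟨ CompletesAll.potential completeAll-correct ⟩
          (unknowns kn₀ ∸ 1) * L                                                   ≡⟨ cong (λ u → (u ∸ 1) * L) (sum-ones (suc m)) ⟩
          m * L                                                                    ∎
          where open ≤-Reasoning

      open Answers (run y askClassSizes) (run y askShiftedSizes) run-askClassSizes run-askShiftedSizes

      decoder-decodes : ∀ i → run y decoder i ≡ lookup y i
      decoder-decodes i = begin
        run y decoder i
          ≡⟨ cong (λ p → run y p i) decoder-stages ⟩
        run y (askClassSizes >>= λ c → askShiftedSizes >>= λ W → completeAll c W >>= λ kn → done (decode kn)) i
          ≡⟨ cong (λ f → f i) (run-pipeline y askClassSizes askShiftedSizes completeAll decode) ⟩
        i ⊕ fromMaybe 𝟘 (run y (completeAll (run y askClassSizes) (run y askShiftedSizes)) i)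
          ≡⟨ cong (λ t → i ⊕ fromMaybe 𝟘 t) (completeAll-complete (shift i) i refl) ⟩
        i ⊕ shift i
          ≡⟨ ⊕-shift i ⟩
        lookup y i
          ∎
        where open ≡-Reasoning

      decoder-cost : cost y decoder ≤ N + (N + m * L)
      decoder-cost = begin
        cost y decoder
          ≡⟨ cong (cost y) decoder-stages ⟩
        cost y (askClassSizes >>= λ c → askShiftedSizes >>= λ W → completeAll c W >>= λ kn → done (decode kn))
          ≡⟨ cost-pipeline y askClassSizes askShiftedSizes completeAll decode ⟩
        cost y askClassSizes + (cost y askShiftedSizes + cost y (completeAll (run y askClassSizes) (run y askShiftedSizes)))
          ≡⟨ cong₂ (λ a b → a + (b + cost y (completeAll (run y askClassSizes) (run y askShiftedSizes))))
                   (cost-askAll y (λ z → askProbe z 0 𝟘) (λ _ → refl)) (cost-askAll y (λ z → askProbe z 1 𝟘) (λ _ → refl)) ⟩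
        N + (N + cost y (completeAll (run y askClassSizes) (run y askShiftedSizes)))
          ≤⟨ +-monoʳ-≤ N (+-monoʳ-≤ N completeAll-cost) ⟩
        N + (N + m * L)
          ∎
        where open ≤-Reasoning

    transcript-bound : ∀ y → IsPerm y → length (transcript (toStrategy decoder) y) ≤ N + (N + m * L)
    transcript-bound y y-perm = ≤-trans (≤-reflexive (length-transcript y decoder)) (Correctness.decoder-cost y y-perm)

  module _ (m L q : ℕ) where
    open ℤ using (+_; _-_) renaming (_+_ to _+ℤ_; _*_ to _*ℤ_; _≤_ to _≤ℤ_)

    cost-bound-ℤ : q ≤ (3 + m) + ((3 + m) + m * L) →
      (+ 2 *ℤ + q) ≤ℤ ((+ 2 *ℤ (+ (3 + m) - + 3) *ℤ + L) +ℤ (+ 5 *ℤ + (3 + m)) - + 2)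
    cost-bound-ℤ q≤ = begin
      + 2 *ℤ + q
        ≡⟨ ℤP.pos-* 2 q ⟨
      + (2 * q)
        ≤⟨ ℤ.+≤+ 2q≤ ⟩
      + (2 * m * L + 5 * m + 13)
        ≡⟨ pos-polynomial ⟩
      + 2 *ℤ + m *ℤ + L +ℤ + 5 *ℤ + m +ℤ + 13
        ≡⟨ rearrange (+ m) (+ L) ⟩
      (+ 2 *ℤ (+ 3 +ℤ + m - + 3) *ℤ + L) +ℤ (+ 5 *ℤ (+ 3 +ℤ + m)) - + 2
        ≡⟨ cong (λ t → (+ 2 *ℤ (t - + 3) *ℤ + L) +ℤ (+ 5 *ℤ t) - + 2) (ℤP.pos-+ 3 m) ⟨
      (+ 2 *ℤ (+ (3 + m) - + 3) *ℤ + L) +ℤ (+ 5 *ℤ + (3 + m)) - + 2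
        ∎
      where
      open ℤP.≤-Reasoning
      2q≤ : 2 * q ≤ 2 * m * L + 5 * m + 13
      2q≤ = ≤-trans (*-monoʳ-≤ 2 q≤) (≤-trans (m≤m+n _ (m + 1)) (≤-reflexive (identity m L)))
        where
        identity : ∀ m L → 2 * ((3 + m) + ((3 + m) + m * L)) + (m + 1) ≡ 2 * m * L + 5 * m + 13
        identity = solve-∀
      pos-polynomial : + (2 * m * L + 5 * m + 13) ≡ + 2 *ℤ + m *ℤ + L +ℤ + 5 *ℤ + m +ℤ + 13
      pos-polynomial = begin-equality
        + (2 * m * L + 5 * m + 13)                  ≡⟨ ℤP.pos-+ (2 * m * L + 5 * m) 13 ⟩
        + (2 * m * L + 5 * m) +ℤ + 13               ≡⟨ cong (_+ℤ + 13) (ℤP.pos-+ (2 * m * L) (5 * m)) ⟩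
        + (2 * m * L) +ℤ + (5 * m) +ℤ + 13          ≡⟨ cong₂ (λ a b → a +ℤ b +ℤ + 13) (ℤP.pos-* (2 * m) L) (ℤP.pos-* 5 m) ⟩
        + (2 * m) *ℤ + L +ℤ + 5 *ℤ + m +ℤ + 13      ≡⟨ cong (λ t → t *ℤ + L +ℤ + 5 *ℤ + m +ℤ + 13) (ℤP.pos-* 2 m) ⟩
        + 2 *ℤ + m *ℤ + L +ℤ + 5 *ℤ + m +ℤ + 13     ∎
      rearrange : ∀ M Λ → + 2 *ℤ M *ℤ Λ +ℤ + 5 *ℤ M +ℤ + 13 ≡ (+ 2 *ℤ (+ 3 +ℤ M - + 3) *ℤ Λ) +ℤ (+ 5 *ℤ (+ 3 +ℤ M)) - + 2
      rearrange = ℤ-Solver.solve-∀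

  -- The cases n = 1 and n = 2

  decoder₁ : Protocols.Protocol 1 (Fin 1 → Fin 1)
  decoder₁ = Protocols.done (λ _ → zero)

  decoder₁-decodes : Protocols.Decodes 1 decoder₁
  decoder₁-decodes (zero ∷ []) _ zero = refl

  identity₂ : Vec (Fin 2) 2
  identity₂ = zero ∷ suc zero ∷ []

  identity₂-isPerm : IsPerm identity₂
  identity₂-isPerm zero zero _ = refl
  identity₂-isPerm zero (suc zero) ()
  identity₂-isPerm (suc zero) zero ()
  identity₂-isPerm (suc zero) (suc zero) _ = refl

  swap₂ : Fin 2 → Fin 2
  swap₂ zero = suc zero
  swap₂ (suc zero) = zero

  decoder₂ : Protocols.Protocol 2 (Fin 2 → Fin 2)
  decoder₂ = Protocols.query identity₂ identity₂-isPerm (λ a → Protocols.done (if a ≡ᵇ 2 then (λ i → i) else swap₂))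

  decoder₂-decodes : Protocols.Decodes 2 decoder₂
  decoder₂-decodes (zero ∷ zero ∷ []) y-perm i with () ← y-perm zero (suc zero) refl
  decoder₂-decodes (zero ∷ suc zero ∷ []) _ zero = refl
  decoder₂-decodes (zero ∷ suc zero ∷ []) _ (suc zero) = refl
  decoder₂-decodes (suc zero ∷ zero ∷ []) _ zero = refl
  decoder₂-decodes (suc zero ∷ zero ∷ []) _ (suc zero) = refl
  decoder₂-decodes (suc zero ∷ suc zero ∷ []) y-perm i with () ← y-perm zero (suc zero) refl

open import Data.Nat using (ℕ; _≤_; zero; suc; z≤n; s≤s)
open import Data.Nat.Logarithm using (⌈log₂_⌉)
open import Data.Integer using (ℤ; +_; _-_; _*_; _+_; +≤+)
open import Data.Fin using (Fin)
open import Data.Vec using (Vec)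
open import Data.List using (length)
open import Data.Product using (Σ; _×_; _,_)
open Mastermind

mainTheorem1 : (n : ℕ) → 1 ≤ n →
    Σ (Strategy n) (λ S → (y : Vec (Fin n) n) → IsPerm y →
    Determines S y ×
    (Data.Integer._≤_ (+ 2 * + length (transcript S y))
    ((+ 2 * (+ n - + 3) * + ⌈log₂ n ⌉) + (+ 5 * + n) - + 2)))
mainTheorem1 1 _ = toStrategy decoder₁ , λ y y-perm → decodes⇒determines decoder₁ decoder₁-decodes y y-perm , +≤+ z≤n
  where open Protocols 1
mainTheorem1 2 _ = toStrategy decoder₂ , λ y y-perm → decodes⇒determines decoder₂ decoder₂-decodes y y-perm , +≤+ (s≤s (s≤s z≤n))
  where open Protocols 2
mainTheorem1 (suc (suc (suc m))) _ = toStrategy decoder , λ y y-perm →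
  decodes⇒determines decoder (λ w w-perm → Correctness.decoder-decodes w w-perm) y y-perm ,
  cost-bound-ℤ m L _ (transcript-bound y y-perm)
  where open Decoder m
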